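{- Let $n\ge2$ and $a_n=(1,0,\ldots,0,1)\in\{0,1\}^n$. Then $\chi(P(a_n);q)=(q-1)^{n-1}$.
   Context: Let $U_n$ be the set of $n\times n$ upper-triangular matrices with nonnegative integer entries. For $A=(a_{i,j})\in U_n$ and $1\le k\le n$, the $k$-th hook sum is $h_k=(a_{k,k}+\cdots+a_{k,n})-(a_{1,k}+\cdots+a_{k-1,k})$. For $\beta\in\mathbb{Z}_{\ge0}^n$, $\mathcal{T}(\beta)$ is the set of $A\in U_n$ with $(h_1,\ldots,h_n)=\beta$. The Tesler poset $P(\beta)$ is the partial order on $\mathcal{T}(\beta)$ that is the reflexive-transitive closure of the cover relation: $A=(a_{ij})$ covers $B=(b_{ij})$ if either there exist $i<j<k$ with $a_{ij}=b_{ij}+1$, $a_{jk}=b_{jk}+1$, $a_{ik}=b_{ik}-1$ and all other entries equal, or there exist $i<j$ with $a_{ij}=b_{ij}+1$, $a_{jj}=b_{jj}+1$, $a_{ii}=b_{ii}-1$ and all other entries equal. Its least element $\hat0$ is the diagonal matrix with diagonal $\beta$; $\rho(A)=\sum_{i<j}a_{ij}$, $\rho(P)=\max_A\rho(A)$; $\chi(P;q)=\sum_{A}\mu(\hat0,A)q^{\rho(P)-\rho(A)}$ with $\mu$ the Möbius function. -}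

module Defs where

open import Data.Nat as ℕ using (ℕ; zero; suc; _∸_; _⊔_)
import Data.Nat.Properties as ℕₚ
import Data.Nat.ListAction as ListAction
open import Data.Integer as ℤ using (ℤ; +_; -_; _-_; _*_; _^_)
open import Data.Fin as Fin using (Fin; toℕ)
import Data.Fin.Properties as Finₚ
open import Data.Vec as Vec using (Vec; lookup; tabulate)
import Data.Vec.Properties as Vecₚ
open import Data.List as List using (List; map; filter; foldr; allFin)
open import Data.Product using (Σ; _×_; _,_; ∃-syntax)
open import Data.Sum using (_⊎_)
open import Data.Bool using (if_then_else_; _∨_)
open import Relation.Nullary using (Dec; yes; no; ¬_; ¬?)
open import Relation.Nullary.Decidable using (_×-dec_; does)
open import Relation.Binary.PropositionalEquality using (_≡_)
open import Relation.Binary.Construct.Closure.ReflexiveTransitive using (Star)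

Matrix : ℕ → Set
Matrix n = Vec (Vec ℕ n) n

entry : ∀ {n} → Matrix n → Fin n → Fin n → ℕ
entry A i j = lookup (lookup A i) j

_≟M_ : ∀ {n} (A B : Matrix n) → Dec (A ≡ B)
_≟M_ = Vecₚ.≡-dec (Vecₚ.≡-dec ℕₚ._≟_)

sumFin : ∀ {n} → (Fin n → ℕ) → ℕ
sumFin {n} f = ListAction.sum (map f (allFin n))

sumℤ : List ℤ → ℤ
sumℤ = foldr ℤ._+_ (+ 0)

UpperTriangular : ∀ {n} → Matrix n → Set
UpperTriangular {n} A = ∀ (i j : Fin n) → j Fin.< i → entry A i j ≡ 0

hook : ∀ {n} → Matrix n → Fin n → ℤ
hook A k =
  + sumFin (λ j → if does (k Fin.≤? j) then entry A k j else 0)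
  - + sumFin (λ i → if does (i Fin.<? k) then entry A i k else 0)

Tesler : ∀ {n} → Vec ℕ n → Matrix n → Set
Tesler {n} β A = UpperTriangular A × (∀ (k : Fin n) → hook A k ≡ + lookup β k)

OthersEqual₃ : ∀ {n} → Matrix n → Matrix n → (Fin n × Fin n) → (Fin n × Fin n) → (Fin n × Fin n) → Set
OthersEqual₃ {n} A B (i₁ , j₁) (i₂ , j₂) (i₃ , j₃) =
  ∀ (r s : Fin n) → ¬ (r ≡ i₁ × s ≡ j₁) → ¬ (r ≡ i₂ × s ≡ j₂) → ¬ (r ≡ i₃ × s ≡ j₃) →
  entry A r s ≡ entry B r s

Covers : ∀ {n} → Matrix n → Matrix n → Set
Covers {n} A B =
  (∃[ i ] ∃[ j ] ∃[ k ] (i Fin.< j × j Fin.< k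
     × entry A i j ≡ entry B i j ℕ.+ 1
     × entry A j k ≡ entry B j k ℕ.+ 1
     × entry A i k ℕ.+ 1 ≡ entry B i k
     × OthersEqual₃ A B (i , j) (j , k) (i , k)))
  ⊎
  (∃[ i ] ∃[ j ] (i Fin.< j
     × entry A i j ≡ entry B i j ℕ.+ 1
     × entry A j j ≡ entry B j j ℕ.+ 1
     × entry A i i ℕ.+ 1 ≡ entry B i i
     × OthersEqual₃ A B (i , j) (j , j) (i , i)))

CoveredBy : ∀ {n} → Matrix n → Matrix n → Set
CoveredBy B A = Covers A B

_≤P_ : ∀ {n} → Matrix n → Matrix n → Set
_≤P_ = Star CoveredBy

-- diagonal matrix with diagonal β  (the least element 0̂)
diagM : ∀ {n} → Vec ℕ n → Matrix n
diagM β = tabulate λ i → tabulate λ j → if does (i Fin.≟ j) then lookup β i else 0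

rank : ∀ {n} → Matrix n → ℕ
rank A = sumFin λ i → sumFin λ j → if does (i Fin.<? j) then entry A i j else 0

-- Data of the finite poset P(β): L is a duplicate-free list of all elements of T(β),
-- and dec decides the order.
module Poset {n : ℕ} (β : Vec ℕ n) (L : List (Matrix n))
             (dec : ∀ (A B : Matrix n) → Dec (A ≤P B)) where

  zeroHat : Matrix n
  zeroHat = diagM β

  rankP : ℕ
  rankP = foldr _⊔_ 0 (map rank L)

  muFuel : ℕ → Matrix n → ℤ
  muFuel zero A = + 0
  muFuel (suc f) A with A ≟M zeroHat
  ... | yes _ = + 1
  ... | no _ = - sumℤ (map (muFuel f)
                 (filter (λ B → dec zeroHat B ×-dec dec B A ×-dec ¬? (B ≟M A)) L))

  -- each step down a strict chain lowers ρ by ≥ 1, so fuel ρ(A)+1 suffices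
  mobius : Matrix n → ℤ
  mobius A = muFuel (suc (rank A)) A

  charPoly : ℤ → ℤ
  charPoly q = sumℤ (map (λ A → mobius A * q ^ (rankP ∸ rank A)) L)

aVec : ∀ n → Vec ℕ n
aVec n = tabulate λ i →
  if does (toℕ i ℕₚ.≟ 0) ∨ does (toℕ i ℕₚ.≟ (n ∸ 1)) then 1 else 0

module Submission where

open import Defs
open import Data.Nat using (ℕ; _≤_; _∸_)
open import Data.Integer using (ℤ; _-_; _^_; +_)
open import Data.List using (List)
open import Data.List.Relation.Unary.Unique.Propositional using (Unique)
open import Data.List.Membership.Propositional using (_∈_)
open import Function.Bundles using (_⇔_)
open import Relation.Nullary using (Dec)
open import Relation.Binary.PropositionalEquality using (_≡_)

open import Data.Nat as N using (zero; suc; _+_; _<_; _⊔_; z≤n; s≤s)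
import Data.Nat.Properties as NP
import Data.Nat.ListAction as LA
open import Data.Nat.Tactic.RingSolver using (solve-∀)
import Data.Integer as Z
import Data.Integer.Properties as ZP
import Data.Integer.Tactic.RingSolver as ZR
open import Data.Fin as F using (Fin; toℕ)
import Data.Fin.Properties as FP
open import Data.Fin.Subset as Sub using (Subset; inside; outside; _⊆_; _⊂_; ∣_∣; Nonempty)
open import Data.Fin.Subset.Properties
  using (_⊆?_; _⊂?_; ∣p∣≤n; ∣⊥∣≡0; ∣⊤∣≡n; ⊥⊆; drop-∷-⊆; s⊂s; out⊂in; ⊂-irref; p⊂q⇒∣p∣<∣q∣; Empty-unique; nonempty?)
import Data.List as L
import Data.List.Properties as LP
import Data.List.Membership.Propositional.Properties as MP
open import Data.List.Membership.Propositional.Properties.WithK using (unique∧set⇒bag)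
import Data.List.Relation.Unary.Unique.Propositional.Properties as UP
open import Data.List.Relation.Unary.Any using (here; there)
import Data.List.Relation.Unary.All as All
import Data.List.Relation.Unary.AllPairs as AllPairs
open import Data.List.Relation.Binary.BagAndSetEquality using (∼bag⇒↭)
open import Data.List.Relation.Binary.Permutation.Propositional using (_↭_; ↭⇒↭ₛ)
open import Data.List.Relation.Binary.Permutation.Propositional.Properties using (map⁺)
import Relation.Binary.PropositionalEquality as ≡
open import Data.List.Relation.Binary.Permutation.Setoid.Properties (≡.setoid ℤ) using (foldr-commMonoid)
import Data.List.Relation.Binary.Sublist.Propositional as Sublist
import Data.Vec as V
import Data.Vec.Properties as VP
open import Data.Bool using (Bool; true; false; if_then_else_; _∨_)
import Data.Bool.Properties as BoolP
open import Data.Product using (_×_; _,_; ∃-syntax; proj₁; proj₂)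
open import Data.Sum using (inj₁; inj₂)
open import Data.Empty using (⊥-elim)
open import Function.Bundles using (mk⇔; Equivalence)
open import Relation.Nullary using (yes; no; ¬_; does; ¬?)
open import Relation.Nullary.Decidable using (_×-dec_; does-⇔)
open import Relation.Binary.Definitions using (Tri; tri<; tri≈; tri>)
open import Relation.Binary.PropositionalEquality
  using (refl; sym; trans; cong; cong₂; subst; subst₂; _≢_; module ≡-Reasoning)
open import Relation.Binary.Construct.Closure.ReflexiveTransitive using (ε; _◅_; _◅◅_; gmap)
open import Algebra.Properties.CommutativeMonoid.Sum NP.+-0-commutativeMonoid
  using (sum; sum-cong-≗; sum-replicate-zero; ∑-distrib-+)

-- The Tesler poset P(a_n), a_n = (1, 0, ..., 0, 1), is the Boolean lattice
-- on n - 1 elements; hence χ(P(a_n); q) = (q - 1)^(n-1).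
--
-- Write n = m + 1.  An element of T(a_n) is an upper triangular matrix whose
-- k-th row sum (from the diagonal on) equals its k-th column sum (above the
-- diagonal) plus [k = 0] + [k = m].  Reading these equations row by row shows
-- that it is a path matrix: unit entries along a path 0 → s₁ → ... → sₖ, one
-- diagonal entry at sₖ and one at m, for a chain 0 < s₁ < ... < sₖ ≤ m.  So
-- T(a_n) is in bijection with the subsets S of {1, ..., m}.  The column sum
-- of column t is [t ∈ S] and column sums grow along covers, while deleting the
-- first node of a chain is a cover; so the order is inclusion and ρ = ∣S∣.
-- Thus μ(0̂, S) = (-1)^∣S∣, since Σ_{T ⊂ S} (-1)^∣T∣ = -(-1)^∣S∣ for S ≠ ∅,
-- and χ = Σ_S (-1)^∣S∣ q^(m - ∣S∣) = (q - 1)^m.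

sumFin≡sum : ∀ {n} (f : Fin n → ℕ) → sumFin f ≡ sum f
sumFin≡sum f = trans (cong LA.sum (LP.map-tabulate (λ i → i) f)) (sum-tabulate f)
  where
  sum-tabulate : ∀ {n} (f : Fin n → ℕ) → LA.sum (L.tabulate f) ≡ sum f
  sum-tabulate {zero} f = refl
  sum-tabulate {suc n} f = cong (λ s → f F.zero + s) (sum-tabulate (λ i → f (F.suc i)))

sum-zero : ∀ {n} (f : Fin n → ℕ) → (∀ i → f i ≡ 0) → sum f ≡ 0
sum-zero {n} f h = trans (sum-cong-≗ h) (sum-replicate-zero n)

sum-single : ∀ {n} (f : Fin n → ℕ) (p : Fin n) → (∀ i → i ≢ p → f i ≡ 0) → sum f ≡ f p
sum-single {suc n} f F.zero h =
  trans (cong (λ s → f F.zero + s) (sum-zero _ (λ i → h (F.suc i) (λ ())))) (NP.+-identityʳ _)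
sum-single {suc n} f (F.suc p) h rewrite h F.zero (λ ()) =
  sum-single (λ i → f (F.suc i)) p (λ i i≢p → h (F.suc i) (λ e → i≢p (FP.suc-injective e)))

term≤sum : ∀ {n} (f : Fin n → ℕ) (p : Fin n) → f p ≤ sum f
term≤sum {suc n} f F.zero = NP.m≤m+n _ _
term≤sum {suc n} f (F.suc p) = NP.≤-trans (term≤sum (λ i → f (F.suc i)) p) (NP.m≤n+m _ _)

twoTerms≤sum : ∀ {n} (f : Fin n → ℕ) (p q : Fin n) → p ≢ q → f p + f q ≤ sum f
twoTerms≤sum {suc n} f F.zero F.zero p≢q = ⊥-elim (p≢q refl)
twoTerms≤sum {suc n} f F.zero (F.suc q) p≢q =
  NP.+-monoʳ-≤ (f F.zero) (term≤sum (λ i → f (F.suc i)) q)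
twoTerms≤sum {suc n} f (F.suc p) F.zero p≢q =
  subst (_≤ sum f) (NP.+-comm (f F.zero) _) (NP.+-monoʳ-≤ (f F.zero) (term≤sum (λ i → f (F.suc i)) p))
twoTerms≤sum {suc n} f (F.suc p) (F.suc q) p≢q =
  NP.≤-trans (twoTerms≤sum (λ i → f (F.suc i)) p q (λ e → p≢q (cong F.suc e))) (NP.m≤n+m _ _)

sum-positive : ∀ {n} (f : Fin n → ℕ) → 1 ≤ sum f → ∃[ i ] (1 ≤ f i)
sum-positive {zero} f ()
sum-positive {suc n} f h with f F.zero in eq
... | suc k = F.zero , subst (1 ≤_) (sym eq) (s≤s z≤n)
... | zero with sum-positive (λ i → f (F.suc i)) h
...   | i , p = F.suc i , p

sum-zero⁻ : ∀ {n} (f : Fin n → ℕ) → sum f ≡ 0 → ∀ i → f i ≡ 0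
sum-zero⁻ f h i = NP.n≤0⇒n≡0 (subst (f i ≤_) h (term≤sum f i))

if-yes : ∀ {P : Set} (d : Dec P) {x : ℕ} → P → (if does d then x else 0) ≡ x
if-yes (yes _) p = refl
if-yes (no ¬p) p = ⊥-elim (¬p p)

if-no : ∀ {P : Set} (d : Dec P) {x : ℕ} → ¬ P → (if does d then x else 0) ≡ 0
if-no (yes p) ¬p = ⊥-elim (¬p p)
if-no (no _) ¬p = refl

if-zero : ∀ (b : Bool) {x : ℕ} → x ≡ 0 → (if b then x else 0) ≡ 0
if-zero true e = e
if-zero false e = refl

if-+ : ∀ (b : Bool) (x y : ℕ) → (if b then x + y else 0) ≡ (if b then x else 0) + (if b then y else 0)
if-+ true x y = refl
if-+ false x y = refl

δ : ℕ → ℕ → ℕ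
δ a b = if does (a N.≟ b) then 1 else 0

δ-≡ : ∀ {a b} → a ≡ b → δ a b ≡ 1
δ-≡ {a} {b} = if-yes (a N.≟ b)

δ-≢ : ∀ {a b} → a ≢ b → δ a b ≡ 0
δ-≢ {a} {b} = if-no (a N.≟ b)

δ-refl : ∀ a → δ a a ≡ 1
δ-refl a = δ-≡ {a} refl

rowSum : ∀ {n} → (Fin n → Fin n → ℕ) → Fin n → ℕ
rowSum f k = sum (λ j → if does (k F.≤? j) then f k j else 0)

colSum : ∀ {n} → (Fin n → Fin n → ℕ) → Fin n → ℕ
colSum f k = sum (λ i → if does (i F.<? k) then f i k else 0)

hook≡rowSum-colSum : ∀ {n} (A : Matrix n) k → hook A k ≡ + rowSum (entry A) k - + colSum (entry A) k
hook≡rowSum-colSum A k = cong₂ (λ x y → + x - + y)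
  (sumFin≡sum (λ j → if does (k F.≤? j) then entry A k j else 0))
  (sumFin≡sum (λ i → if does (i F.<? k) then entry A i k else 0))

rowSum-+ : ∀ {n} (f g : Fin n → Fin n → ℕ) k → rowSum (λ i j → f i j + g i j) k ≡ rowSum f k + rowSum g k
rowSum-+ f g k = trans (sum-cong-≗ (λ j → if-+ (does (k F.≤? j)) (f k j) (g k j)))
  (∑-distrib-+ (λ j → if does (k F.≤? j) then f k j else 0) (λ j → if does (k F.≤? j) then g k j else 0))

colSum-+ : ∀ {n} (f g : Fin n → Fin n → ℕ) k → colSum (λ i j → f i j + g i j) k ≡ colSum f k + colSum g k
colSum-+ f g k = trans (sum-cong-≗ (λ i → if-+ (does (i F.<? k)) (f i k) (g i k)))
  (∑-distrib-+ (λ i → if does (i F.<? k) then f i k else 0) (λ i → if does (i F.<? k) then g i k else 0))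

rowSum-cong : ∀ {n} {f g : Fin n → Fin n → ℕ} → (∀ i j → f i j ≡ g i j) → ∀ k → rowSum f k ≡ rowSum g k
rowSum-cong h k = sum-cong-≗ (λ j → cong (λ x → if does (k F.≤? j) then x else 0) (h k j))

colSum-cong : ∀ {n} {f g : Fin n → Fin n → ℕ} → (∀ i j → f i j ≡ g i j) → ∀ k → colSum f k ≡ colSum g k
colSum-cong h k = sum-cong-≗ (λ i → cong (λ x → if does (i F.<? k) then x else 0) (h i k))

hookEq⇒ : ∀ r b c → + r - + c ≡ + b → r ≡ c + b
hookEq⇒ r b c h = ZP.+-injective (begin
  + r                ≡⟨ add-sub (+ r) (+ c) ⟩
  (+ r - + c) Z.+ + c ≡⟨ cong (Z._+ + c) h ⟩
  + (b + c)          ≡⟨ cong +_ (NP.+-comm b c) ⟩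
  + (c + b)          ∎)
  where
  open ≡-Reasoning
  add-sub : ∀ (x y : ℤ) → x ≡ (x - y) Z.+ y
  add-sub = ZR.solve-∀

hookEq⇐ : ∀ r b c → r ≡ c + b → + r - + c ≡ + b
hookEq⇐ r b c refl = trans (cong (_- + c) (ZP.pos-+ c b)) (sub-add (+ c) (+ b))
  where
  sub-add : ∀ (x y : ℤ) → (x Z.+ y) - x ≡ y
  sub-add = ZR.solve-∀

unit : ℕ → ℕ → ℕ → ℕ → ℕ
unit u v i j = δ i u N.* δ j v

unit-offRow : ∀ u v i j → i ≢ u → unit u v i j ≡ 0
unit-offRow u v i j ne rewrite δ-≢ ne = refl

unit-offCol : ∀ u v i j → j ≢ v → unit u v i j ≡ 0
unit-offCol u v i j ne rewrite δ-≢ ne = NP.*-zeroʳ (δ i u)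

unit-hit : ∀ u v → unit u v u v ≡ 1
unit-hit u v rewrite δ-refl u | δ-refl v = refl

unit-lower : ∀ {u v i j} → u ≤ v → j < i → unit u v i j ≡ 0
unit-lower {u} {v} {i} {j} u≤v j<i with i N.≟ u | j N.≟ v
... | no ne | _ = unit-offRow u v i j ne
... | yes _ | no ne = unit-offCol u v i j ne
... | yes refl | yes refl = ⊥-elim (NP.<⇒≱ j<i u≤v)

unit-diag : ∀ u i → unit u u i i ≡ δ i u
unit-diag u i with i N.≟ u
... | yes i≡u rewrite δ-≡ i≡u = refl
... | no i≢u rewrite δ-≢ i≢u = refl

unit-offDiag : ∀ u {i j} → i ≢ j → unit u u i j ≡ 0
unit-offDiag u {i} {j} ne with i N.≟ u
... | no ne' = unit-offRow u u i j ne'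
... | yes refl = unit-offCol u u i j (λ e → ne (sym e))

sumℤ-↭ : ∀ {A : Set} (g : A → ℤ) {xs ys} → xs ↭ ys → sumℤ (L.map g xs) ≡ sumℤ (L.map g ys)
sumℤ-↭ g p = foldr-commMonoid ZP.+-0-isCommutativeMonoid (↭⇒↭ₛ (map⁺ g p))

sumℤ-cong : ∀ {A : Set} (g h : A → ℤ) xs → (∀ x → x ∈ xs → g x ≡ h x) → sumℤ (L.map g xs) ≡ sumℤ (L.map h xs)
sumℤ-cong g h L.[] eq = refl
sumℤ-cong g h (x L.∷ xs) eq = cong₂ Z._+_ (eq x (here refl)) (sumℤ-cong g h xs (λ y p → eq y (there p)))

sumℤ-filter : ∀ {A : Set} {P : A → Set} (P? : ∀ x → Dec (P x)) (h : A → ℤ) xs →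
              sumℤ (L.map h (L.filter P? xs)) ≡ sumℤ (L.map (λ x → if does (P? x) then h x else + 0) xs)
sumℤ-filter P? h L.[] = refl
sumℤ-filter P? h (x L.∷ xs) with does (P? x)
... | true = cong (λ z → h x Z.+ z) (sumℤ-filter P? h xs)
... | false = trans (sumℤ-filter P? h xs) (sym (ZP.+-identityˡ _))

sumℤ-++ : ∀ xs ys → sumℤ (xs L.++ ys) ≡ sumℤ xs Z.+ sumℤ ys
sumℤ-++ L.[] ys = sym (ZP.+-identityˡ _)
sumℤ-++ (x L.∷ xs) ys = trans (cong (λ z → x Z.+ z) (sumℤ-++ xs ys)) (sym (ZP.+-assoc x _ _))

sumℤ-map-∘ : ∀ {A B : Set} (g : B → ℤ) (f : A → B) xs → sumℤ (L.map g (L.map f xs)) ≡ sumℤ (L.map (λ x → g (f x)) xs)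
sumℤ-map-∘ g f xs = cong sumℤ (sym (LP.map-∘ xs))

sumℤ-scale : ∀ {A : Set} (a : ℤ) (g : A → ℤ) xs → sumℤ (L.map (λ x → a Z.* g x) xs) ≡ a Z.* sumℤ (L.map g xs)
sumℤ-scale a g L.[] = sym (ZP.*-zeroʳ a)
sumℤ-scale a g (x L.∷ xs) = trans (cong (λ z → a Z.* g x Z.+ z) (sumℤ-scale a g xs)) (sym (ZP.*-distribˡ-+ a (g x) _))

sumℤ-neg : ∀ {A : Set} (g : A → ℤ) xs → sumℤ (L.map (λ x → Z.- g x) xs) ≡ Z.- sumℤ (L.map g xs)
sumℤ-neg g L.[] = refl
sumℤ-neg g (x L.∷ xs) = trans (cong (λ z → Z.- g x Z.+ z) (sumℤ-neg g xs)) (sym (ZP.neg-distrib-+ (g x) _))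

sumℤ-zero : ∀ {A : Set} (xs : List A) → sumℤ (L.map (λ _ → + 0) xs) ≡ + 0
sumℤ-zero L.[] = refl
sumℤ-zero (x L.∷ xs) = trans (ZP.+-identityˡ _) (sumℤ-zero xs)

allSubsets : ∀ k → List (Subset k)
allSubsets zero = V.[] L.∷ L.[]
allSubsets (suc k) = L.map (outside V.∷_) (allSubsets k) L.++ L.map (inside V.∷_) (allSubsets k)

allSubsets-complete : ∀ {k} (S : Subset k) → S ∈ allSubsets k
allSubsets-complete V.[] = here refl
allSubsets-complete {suc k} (outside V.∷ S) = MP.∈-++⁺ˡ (MP.∈-map⁺ (outside V.∷_) (allSubsets-complete S))
allSubsets-complete {suc k} (inside V.∷ S) =
  MP.∈-++⁺ʳ (L.map (outside V.∷_) (allSubsets k)) (MP.∈-map⁺ (inside V.∷_) (allSubsets-complete S))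

allSubsets-unique : ∀ k → Unique (allSubsets k)
allSubsets-unique zero = All.[] AllPairs.∷ AllPairs.[]
allSubsets-unique (suc k) =
  UP.++⁺ (UP.map⁺ VP.∷-injectiveʳ (allSubsets-unique k)) (UP.map⁺ VP.∷-injectiveʳ (allSubsets-unique k)) disjoint
  where
  disjoint : ∀ {S} → ¬ (S ∈ L.map (outside V.∷_) (allSubsets k) × S ∈ L.map (inside V.∷_) (allSubsets k))
  disjoint (p , q) with MP.∈-map⁻ (outside V.∷_) p | MP.∈-map⁻ (inside V.∷_) q
  ... | (_ , _ , refl) | (_ , _ , ())

sumSubsets : ∀ k → (Subset k → ℤ) → ℤ
sumSubsets k F = sumℤ (L.map F (allSubsets k))

sumSubsets-suc : ∀ k (F : Subset (suc k) → ℤ) →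
  sumSubsets (suc k) F ≡ sumSubsets k (λ T → F (outside V.∷ T)) Z.+ sumSubsets k (λ T → F (inside V.∷ T))
sumSubsets-suc k F = begin
  sumℤ (L.map F (L.map (outside V.∷_) (allSubsets k) L.++ L.map (inside V.∷_) (allSubsets k)))
    ≡⟨ cong sumℤ (LP.map-++ F (L.map (outside V.∷_) (allSubsets k)) _) ⟩
  sumℤ (L.map F (L.map (outside V.∷_) (allSubsets k)) L.++ L.map F (L.map (inside V.∷_) (allSubsets k)))
    ≡⟨ sumℤ-++ (L.map F (L.map (outside V.∷_) (allSubsets k))) _ ⟩
  sumℤ (L.map F (L.map (outside V.∷_) (allSubsets k))) Z.+ sumℤ (L.map F (L.map (inside V.∷_) (allSubsets k)))
    ≡⟨ cong₂ Z._+_ (sumℤ-map-∘ F (outside V.∷_) (allSubsets k)) (sumℤ-map-∘ F (inside V.∷_) (allSubsets k)) ⟩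
  sumSubsets k (λ T → F (outside V.∷ T)) Z.+ sumSubsets k (λ T → F (inside V.∷ T)) ∎
  where open ≡-Reasoning

sumSubsets-cong : ∀ k {F G : Subset k → ℤ} → (∀ S → F S ≡ G S) → sumSubsets k F ≡ sumSubsets k G
sumSubsets-cong k {F} {G} eq = sumℤ-cong F G (allSubsets k) (λ S _ → eq S)

sign : ℕ → ℤ
sign zero = + 1
sign (suc k) = Z.- sign k

if-neg : ∀ (b : Bool) (x : ℤ) → (if b then Z.- x else + 0) ≡ Z.- (if b then x else + 0)
if-neg true x = refl
if-neg false x = refl

if-cong : ∀ {P : Set} (d : Dec P) {x y : ℤ} → (P → x ≡ y) → (if does d then x else + 0) ≡ (if does d then y else + 0)
if-cong (yes p) eq = eq p
if-cong (no _) eq = refl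

downSum : ∀ {k} → Subset k → ℤ
downSum {k} S = sumSubsets k (λ T → if does (T ⊆? S) then sign ∣ T ∣ else + 0)

strictDownSum : ∀ {k} → Subset k → ℤ
strictDownSum {k} S = sumSubsets k (λ T → if does (T ⊂? S) then sign ∣ T ∣ else + 0)

negatedHalf : ∀ {k} (P? : Subset k → Bool) →
  sumSubsets k (λ T → if P? T then sign ∣ inside V.∷ T ∣ else + 0) ≡ Z.- sumSubsets k (λ T → if P? T then sign ∣ T ∣ else + 0)
negatedHalf {k} P? = trans (sumSubsets-cong k (λ T → if-neg (P? T) (sign ∣ T ∣))) (sumℤ-neg _ (allSubsets k))

downSum-outside : ∀ {k} (S : Subset k) → downSum (outside V.∷ S) ≡ downSum S
downSum-outside {k} S = trans (sumSubsets-suc k _) (trans (cong (λ z → downSum S Z.+ z) (sumℤ-zero (allSubsets k))) (ZP.+-identityʳ _))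

downSum-inside : ∀ {k} (S : Subset k) → downSum (inside V.∷ S) ≡ + 0
downSum-inside {k} S =
  trans (sumSubsets-suc k _) (trans (cong (λ z → downSum S Z.+ z) (negatedHalf (λ T → does (T ⊆? S)))) (ZP.+-inverseʳ (downSum S)))

downSum-nonempty : ∀ {k} (S : Subset k) → Nonempty S → downSum S ≡ + 0
downSum-nonempty (inside V.∷ S) _ = downSum-inside S
downSum-nonempty (outside V.∷ S) (F.suc x , V.there x∈S) = trans (downSum-outside S) (downSum-nonempty S (x , x∈S))

strictDownSum≡ : ∀ {k} (S : Subset k) → strictDownSum S ≡ downSum S - sign ∣ S ∣
strictDownSum≡ V.[] = refl
strictDownSum≡ {suc k} (outside V.∷ S) = begin
  strictDownSum (outside V.∷ S)                              ≡⟨ sumSubsets-suc k _ ⟩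
  strictDownSum S Z.+ sumℤ (L.map (λ _ → + 0) (allSubsets k)) ≡⟨ cong (λ z → strictDownSum S Z.+ z) (sumℤ-zero (allSubsets k)) ⟩
  strictDownSum S Z.+ + 0                                    ≡⟨ ZP.+-identityʳ _ ⟩
  strictDownSum S                                            ≡⟨ strictDownSum≡ S ⟩
  downSum S - sign ∣ S ∣                                     ≡⟨ cong (_- sign ∣ S ∣) (sym (downSum-outside S)) ⟩
  downSum (outside V.∷ S) - sign ∣ S ∣                       ∎
  where open ≡-Reasoning
strictDownSum≡ {suc k} (inside V.∷ S) = begin
  strictDownSum (inside V.∷ S)                               ≡⟨ sumSubsets-suc k _ ⟩
  downSum S Z.+ sumSubsets k (λ T → if does (T ⊂? S) then sign ∣ inside V.∷ T ∣ else + 0)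
                                                             ≡⟨ cong (λ z → downSum S Z.+ z) (negatedHalf (λ T → does (T ⊂? S))) ⟩
  downSum S Z.+ Z.- strictDownSum S                          ≡⟨ cong (λ x → downSum S Z.+ Z.- x) (strictDownSum≡ S) ⟩
  downSum S Z.+ Z.- (downSum S - sign ∣ S ∣)                 ≡⟨ cancel (downSum S) (sign ∣ S ∣) ⟩
  + 0 - Z.- sign ∣ S ∣                                       ≡⟨ cong (λ x → x - Z.- sign ∣ S ∣) (sym (downSum-inside S)) ⟩
  downSum (inside V.∷ S) - sign ∣ inside V.∷ S ∣             ∎
  where
  open ≡-Reasoning
  cancel : ∀ d s → d Z.+ Z.- (d - s) ≡ + 0 - Z.- s
  cancel = ZR.solve-∀

strictDownSum-nonempty : ∀ {k} (S : Subset k) → Nonempty S → strictDownSum S ≡ Z.- sign ∣ S ∣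
strictDownSum-nonempty S ne = trans (strictDownSum≡ S) (trans (cong (_- sign ∣ S ∣) (downSum-nonempty S ne)) (ZP.+-identityˡ _))

alternatingRankSum : ∀ k (q : ℤ) → sumSubsets k (λ S → sign ∣ S ∣ Z.* q ^ (k ∸ ∣ S ∣)) ≡ (q - + 1) ^ k
alternatingRankSum zero q = refl
alternatingRankSum (suc k) q = begin
  sumSubsets (suc k) (λ S → sign ∣ S ∣ Z.* q ^ (suc k ∸ ∣ S ∣))     ≡⟨ sumSubsets-suc k _ ⟩
  sumSubsets k (λ T → sign ∣ T ∣ Z.* q ^ (suc k ∸ ∣ T ∣)) Z.+ sumSubsets k (λ T → Z.- sign ∣ T ∣ Z.* q ^ (k ∸ ∣ T ∣))
                                                                    ≡⟨ cong₂ Z._+_ withoutNew withNew ⟩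
  q Z.* rest Z.+ Z.- rest                                           ≡⟨ factor q rest ⟩
  (q - + 1) Z.* rest                                                ≡⟨ cong (λ z → (q - + 1) Z.* z) (alternatingRankSum k q) ⟩
  (q - + 1) ^ suc k                                                 ∎
  where
  open ≡-Reasoning
  rest : ℤ
  rest = sumSubsets k (λ T → sign ∣ T ∣ Z.* q ^ (k ∸ ∣ T ∣))
  withoutNew : sumSubsets k (λ T → sign ∣ T ∣ Z.* q ^ (suc k ∸ ∣ T ∣)) ≡ q Z.* rest
  withoutNew = trans (sumSubsets-cong k (λ T → trans (cong (λ e → sign ∣ T ∣ Z.* q ^ e) (NP.+-∸-assoc 1 (∣p∣≤n T)))
                                                     (swap (sign ∣ T ∣) q (q ^ (k ∸ ∣ T ∣)))))
                     (sumℤ-scale q _ (allSubsets k))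
    where
    swap : ∀ a q b → a Z.* (q Z.* b) ≡ q Z.* (a Z.* b)
    swap = ZR.solve-∀
  withNew : sumSubsets k (λ T → Z.- sign ∣ T ∣ Z.* q ^ (k ∸ ∣ T ∣)) ≡ Z.- rest
  withNew = trans (sumSubsets-cong k (λ T → sym (ZP.neg-distribˡ-* (sign ∣ T ∣) _))) (sumℤ-neg _ (allSubsets k))
  factor : ∀ q r → q Z.* r Z.+ Z.- r ≡ (q - + 1) Z.* r
  factor = ZR.solve-∀

⊆∧≢⇒⊂ : ∀ {k} {T S : Subset k} → T ⊆ S → T ≢ S → T ⊂ S
⊆∧≢⇒⊂ {T = V.[]} {V.[]} _ T≢S = ⊥-elim (T≢S refl)
⊆∧≢⇒⊂ {T = outside V.∷ T} {inside V.∷ S} T⊆S _ = out⊂in (drop-∷-⊆ T⊆S)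
⊆∧≢⇒⊂ {T = inside V.∷ T} {outside V.∷ S} T⊆S _ with T⊆S V.here
... | ()
⊆∧≢⇒⊂ {T = outside V.∷ T} {outside V.∷ S} T⊆S T≢S = s⊂s (⊆∧≢⇒⊂ (drop-∷-⊆ T⊆S) (λ e → T≢S (cong (outside V.∷_) e)))
⊆∧≢⇒⊂ {T = inside V.∷ T} {inside V.∷ S} T⊆S T≢S = s⊂s (⊆∧≢⇒⊂ (drop-∷-⊆ T⊆S) (λ e → T≢S (cong (inside V.∷_) e)))

≢⊥⇒nonempty : ∀ {k} (S : Subset k) → S ≢ Sub.⊥ → Nonempty S
≢⊥⇒nonempty S S≢⊥ with nonempty? S
... | yes ne = ne
... | no empty = ⊥-elim (S≢⊥ (Empty-unique empty))

foldr-⊔-lub : ∀ xs b → (∀ x → x ∈ xs → x ≤ b) → L.foldr _⊔_ 0 xs ≤ b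
foldr-⊔-lub L.[] b h = z≤n
foldr-⊔-lub (x L.∷ xs) b h = NP.⊔-lub (h x (here refl)) (foldr-⊔-lub xs b (λ y p → h y (there p)))

foldr-⊔-ub : ∀ xs x → x ∈ xs → x ≤ L.foldr _⊔_ 0 xs
foldr-⊔-ub (y L.∷ xs) x (here refl) = NP.m≤m⊔n x _
foldr-⊔-ub (y L.∷ xs) x (there p) = NP.≤-trans (foldr-⊔-ub xs x p) (NP.m≤n⊔m y _)

data Chain (n : ℕ) : ℕ → List ℕ → Set where
  end : ∀ {u} → u < n → Chain n u L.[]
  step : ∀ {u v vs} → u < v → Chain n v vs → Chain n u (v L.∷ vs)

chain-bound : ∀ {n u vs} → Chain n u vs → u < n
chain-bound (end u<n) = u<n
chain-bound (step u<v c) = NP.<-trans u<v (chain-bound c)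

chain-weaken : ∀ {n u v vs} → u < v → Chain n v vs → Chain n u vs
chain-weaken u<v (end v<n) = end (NP.<-trans u<v v<n)
chain-weaken u<v (step v<w c) = step (NP.<-trans u<v v<w) c

pathFun : ℕ → List ℕ → ℕ → ℕ → ℕ
pathFun u L.[] i j = unit u u i j
pathFun u (v L.∷ vs) i j = unit u v i j + pathFun v vs i j

occurrences : ℕ → List ℕ → ℕ
occurrences k L.[] = 0
occurrences k (v L.∷ vs) = δ k v + occurrences k vs

module Matrices (m : ℕ) where

  n : ℕ
  n = suc m

  Entries : Set
  Entries = Fin n → Fin n → ℕ

  lift : (ℕ → ℕ → ℕ) → Entries
  lift G i j = G (toℕ i) (toℕ j)

  fromFun : (ℕ → ℕ → ℕ) → Matrix n
  fromFun G = V.tabulate (λ i → V.tabulate (λ j → G (toℕ i) (toℕ j)))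

  entry-fromFun : ∀ G i j → entry (fromFun G) i j ≡ G (toℕ i) (toℕ j)
  entry-fromFun G i j =
    trans (cong (λ r → V.lookup r j) (VP.lookup∘tabulate (λ i → V.tabulate (λ j → G (toℕ i) (toℕ j))) i))
          (VP.lookup∘tabulate (λ j → G (toℕ i) (toℕ j)) j)

  matrix-ext : ∀ (A : Matrix n) G → (∀ i j → entry A i j ≡ G (toℕ i) (toℕ j)) → A ≡ fromFun G
  matrix-ext A G h = trans (sym (VP.tabulate∘lookup A))
    (VP.tabulate-cong (λ i → trans (sym (VP.tabulate∘lookup (V.lookup A i))) (VP.tabulate-cong (λ j → h i j))))

  fromFun-cong : ∀ {G G'} → (∀ i j → G i j ≡ G' i j) → fromFun G ≡ fromFun G'
  fromFun-cong {G} {G'} e = matrix-ext (fromFun G) G' (λ i j → trans (entry-fromFun G i j) (e (toℕ i) (toℕ j)))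

  idx : ∀ {v} → v < n → Fin n
  idx p = F.fromℕ< p

  toℕ-idx : ∀ {v} (p : v < n) → toℕ (idx p) ≡ v
  toℕ-idx p = FP.toℕ-fromℕ< p

  idx-unique : ∀ {u} (p : u < n) (i : Fin n) → toℕ i ≡ u → i ≡ idx p
  idx-unique p i e = FP.toℕ-injective (trans e (sym (toℕ-idx p)))

  ≢idx : ∀ {v} (p : v < n) (i : Fin n) → i ≢ idx p → toℕ i ≢ v
  ≢idx p i ne e = ne (idx-unique p i e)

  m<n : m < n
  m<n = NP.n<1+n m

  last : Fin n
  last = idx m<n

  toℕ-last : toℕ last ≡ m
  toℕ-last = toℕ-idx m<n

  toℕ≤m : ∀ (i : Fin n) → toℕ i ≤ m
  toℕ≤m i = NP.≤-pred (FP.toℕ<n i)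

  rowSum-unit : ∀ u v → u ≤ v → v < n → ∀ k → rowSum (lift (unit u v)) k ≡ δ (toℕ k) u
  rowSum-unit u v u≤v v<n k =
    trans (sum-single {n} (λ j → if does (k F.≤? j) then unit u v (toℕ k) (toℕ j) else 0) (idx v<n)
             (λ j ne → if-zero (does (k F.≤? j)) (unit-offCol u v (toℕ k) (toℕ j) (≢idx v<n j ne)))) atV
    where
    atV : (if does (k F.≤? idx v<n) then unit u v (toℕ k) (toℕ (idx v<n)) else 0) ≡ δ (toℕ k) u
    atV with toℕ k N.≟ u
    ... | no ne = trans (if-zero (does (k F.≤? idx v<n)) (unit-offRow u v (toℕ k) (toℕ (idx v<n)) ne)) (sym (δ-≢ ne))
    ... | yes eq = trans (if-yes (k F.≤? idx v<n) (subst₂ _≤_ (sym eq) (sym (toℕ-idx v<n)) u≤v))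
      (trans (cong₂ (unit u v) eq (toℕ-idx v<n)) (trans (unit-hit u v) (sym (δ-≡ eq))))

  colSum-unit : ∀ u v → u < v → v < n → ∀ k → colSum (lift (unit u v)) k ≡ δ (toℕ k) v
  colSum-unit u v u<v v<n k =
    trans (sum-single {n} (λ i → if does (i F.<? k) then unit u v (toℕ i) (toℕ k) else 0) (idx u<n)
             (λ i ne → if-zero (does (i F.<? k)) (unit-offRow u v (toℕ i) (toℕ k) (≢idx u<n i ne)))) atU
    where
    u<n : u < n
    u<n = NP.<-trans u<v v<n
    atU : (if does (idx u<n F.<? k) then unit u v (toℕ (idx u<n)) (toℕ k) else 0) ≡ δ (toℕ k) v
    atU with toℕ k N.≟ v
    ... | no ne = trans (if-zero (does (idx u<n F.<? k)) (unit-offCol u v (toℕ (idx u<n)) (toℕ k) ne)) (sym (δ-≢ ne))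
    ... | yes eq = trans (if-yes (idx u<n F.<? k) (subst₂ _<_ (sym (toℕ-idx u<n)) (sym eq) u<v))
      (trans (cong₂ (unit u v) (toℕ-idx u<n) eq) (trans (unit-hit u v) (sym (δ-≡ eq))))

  colSum-unitDiag : ∀ u k → colSum (lift (unit u u)) k ≡ 0
  colSum-unitDiag u k = sum-zero {n} (λ i → if does (i F.<? k) then unit u u (toℕ i) (toℕ k) else 0) vanish
    where
    vanish : ∀ i → (if does (i F.<? k) then unit u u (toℕ i) (toℕ k) else 0) ≡ 0
    vanish i with toℕ i N.≟ toℕ k
    ... | no ne = if-zero (does (i F.<? k)) (unit-offDiag u ne)
    ... | yes e = if-no (i F.<? k) (λ lt → NP.<-irrefl e lt)

  -- The entry function of the Tesler matrix with hook vector e_u + e_m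
  -- belonging to the chain vs above u: the path from u plus a loop at m.
  teslerFun : ℕ → List ℕ → ℕ → ℕ → ℕ
  teslerFun u vs i j = pathFun u vs i j + unit m m i j

  rowSum-path : ∀ {u vs} → Chain n u vs → ∀ k → rowSum (lift (pathFun u vs)) k ≡ δ (toℕ k) u + occurrences (toℕ k) vs
  rowSum-path {u} (end u<n) k = trans (rowSum-unit u u NP.≤-refl u<n k) (sym (NP.+-identityʳ _))
  rowSum-path {u} {v L.∷ vs} (step u<v c) k =
    trans (rowSum-+ (lift (unit u v)) (lift (pathFun v vs)) k)
          (cong₂ _+_ (rowSum-unit u v (NP.<⇒≤ u<v) (chain-bound c) k) (rowSum-path c k))

  colSum-path : ∀ {u vs} → Chain n u vs → ∀ k → colSum (lift (pathFun u vs)) k ≡ occurrences (toℕ k) vs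
  colSum-path {u} (end u<n) k = colSum-unitDiag u k
  colSum-path {u} {v L.∷ vs} (step u<v c) k =
    trans (colSum-+ (lift (unit u v)) (lift (pathFun v vs)) k)
          (cong₂ _+_ (colSum-unit u v u<v (chain-bound c) k) (colSum-path c k))

  rowSum-tesler : ∀ {u vs} → Chain n u vs → ∀ k →
                  rowSum (lift (teslerFun u vs)) k ≡ (δ (toℕ k) u + occurrences (toℕ k) vs) + δ (toℕ k) m
  rowSum-tesler {u} {vs} c k = trans (rowSum-+ (lift (pathFun u vs)) (lift (unit m m)) k)
    (cong₂ _+_ (rowSum-path c k) (rowSum-unit m m NP.≤-refl m<n k))

  colSum-tesler : ∀ {u vs} → Chain n u vs → ∀ k → colSum (lift (teslerFun u vs)) k ≡ occurrences (toℕ k) vs + 0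
  colSum-tesler {u} {vs} c k = trans (colSum-+ (lift (pathFun u vs)) (lift (unit m m)) k)
    (cong₂ _+_ (colSum-path c k) (colSum-unitDiag m k))

  path-upper : ∀ {u vs} → Chain n u vs → ∀ {i j} → j < i → pathFun u vs i j ≡ 0
  path-upper (end _) j<i = unit-lower NP.≤-refl j<i
  path-upper (step u<v c) j<i = cong₂ _+_ (unit-lower (NP.<⇒≤ u<v) j<i) (path-upper c j<i)

  path-rowsAbove : ∀ {u vs} → Chain n u vs → ∀ {i} j → i < u → pathFun u vs i j ≡ 0
  path-rowsAbove {u} (end _) {i} j i<u = unit-offRow u u i j (λ e → NP.<-irrefl e i<u)
  path-rowsAbove {u} (step u<v c) {i} j i<u =
    cong₂ _+_ (unit-offRow u _ i j (λ e → NP.<-irrefl e i<u)) (path-rowsAbove c j (NP.<-trans i<u u<v))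

  aVec≡δ : 1 ≤ m → ∀ (k : Fin n) → V.lookup (aVec n) k ≡ δ (toℕ k) 0 + δ (toℕ k) m
  aVec≡δ 1≤m k =
    trans (VP.lookup∘tabulate (λ i → if does (toℕ i N.≟ 0) ∨ does (toℕ i N.≟ m) then 1 else 0) k) (atIndex (toℕ k))
    where
    atIndex : ∀ a → (if does (a N.≟ 0) ∨ does (a N.≟ m) then 1 else 0) ≡ δ a 0 + δ a m
    atIndex zero rewrite δ-≢ {0} {m} (λ e → NP.<-irrefl e 1≤m) = refl
    atIndex (suc a) = refl

  tesler-path : 1 ≤ m → ∀ {vs} → Chain n 0 vs → Tesler (aVec n) (fromFun (teslerFun 0 vs))
  tesler-path 1≤m {vs} c = upper , hooks
    where
    upper : UpperTriangular (fromFun (teslerFun 0 vs))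
    upper i j j<i = trans (entry-fromFun (teslerFun 0 vs) i j) (cong₂ _+_ (path-upper c j<i) (unit-lower NP.≤-refl j<i))
    rearrange : ∀ x y z → (x + y) + z ≡ (y + 0) + (x + z)
    rearrange = solve-∀
    hooks : ∀ k → hook (fromFun (teslerFun 0 vs)) k ≡ + V.lookup (aVec n) k
    hooks k = begin
      hook (fromFun (teslerFun 0 vs)) k
        ≡⟨ hook≡rowSum-colSum (fromFun (teslerFun 0 vs)) k ⟩
      + rowSum (entry (fromFun (teslerFun 0 vs))) k - + colSum (entry (fromFun (teslerFun 0 vs))) k
        ≡⟨ cong₂ (λ a b → + a - + b) (trans (rowSum-cong (entry-fromFun (teslerFun 0 vs)) k) (rowSum-tesler c k))
                                       (trans (colSum-cong (entry-fromFun (teslerFun 0 vs)) k) (colSum-tesler c k)) ⟩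
      + ((δ (toℕ k) 0 + occurrences (toℕ k) vs) + δ (toℕ k) m) - + (occurrences (toℕ k) vs + 0)
        ≡⟨ hookEq⇐ _ _ (occurrences (toℕ k) vs + 0) (rearrange (δ (toℕ k) 0) (occurrences (toℕ k) vs) (δ (toℕ k) m)) ⟩
      + (δ (toℕ k) 0 + δ (toℕ k) m)
        ≡⟨ cong +_ (sym (aVec≡δ 1≤m k)) ⟩
      + V.lookup (aVec n) k ∎
      where open ≡-Reasoning

  Upper : Entries → Set
  Upper f = ∀ i j → toℕ j < toℕ i → f i j ≡ 0

  ClearAbove : Entries → ℕ → Set
  ClearAbove f u = ∀ i j → toℕ i < u → u ≤ toℕ j → f i j ≡ 0

  HooksFrom : Entries → ℕ → Set
  HooksFrom f u = ∀ k → u ≤ toℕ k → rowSum f k ≡ colSum f k + (δ (toℕ k) u + δ (toℕ k) m)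

  -- the state of the classification when rows 0, ..., u-1 have been explained
  record Invariant (f : Entries) (u : ℕ) : Set where
    field
      upper : Upper f
      clear : ClearAbove f u
      hooks : HooksFrom f u

  AgreesFrom : ℕ → Entries → (ℕ → ℕ → ℕ) → Set
  AgreesFrom u f G = ∀ i j → u ≤ toℕ i → f i j ≡ G (toℕ i) (toℕ j)

  row-vanish : ∀ {f} → Upper f → ∀ i → rowSum f i ≡ 0 → ∀ j → f i j ≡ 0
  row-vanish {f} up i h j with toℕ i N.≤? toℕ j
  ... | yes i≤j = trans (sym (if-yes (i F.≤? j) i≤j)) (sum-zero⁻ {n} (λ j → if does (i F.≤? j) then f i j else 0) h j)
  ... | no i≰j = up i j (NP.≰⇒> i≰j)

  colSum-vanish : ∀ f k → (∀ i → toℕ i < toℕ k → f i k ≡ 0) → colSum f k ≡ 0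
  colSum-vanish f k h = sum-zero {n} (λ i → if does (i F.<? k) then f i k else 0) term
    where
    term : ∀ i → (if does (i F.<? k) then f i k else 0) ≡ 0
    term i with toℕ i N.<? toℕ k
    ... | yes i<k = trans (if-yes (i F.<? k) i<k) (h i i<k)
    ... | no i≮k = if-no (i F.<? k) i≮k

  rowSum-last : ∀ f → rowSum f last ≡ f last last
  rowSum-last f = trans (sum-single {n} (λ j → if does (last F.≤? j) then f last j else 0) last offLast)
                        (if-yes (last F.≤? last) NP.≤-refl)
    where
    offLast : ∀ j → j ≢ last → (if does (last F.≤? j) then f last j else 0) ≡ 0
    offLast j ne = if-no (last F.≤? j) (λ le → ne (idx-unique m<n j
      (NP.≤-antisym (toℕ≤m j) (subst (_≤ toℕ j) toℕ-last le))))

  row-single : ∀ {f} → Upper f → ∀ k → rowSum f k ≡ 1 →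
               ∃[ j ] (toℕ k ≤ toℕ j × f k j ≡ 1 × (∀ j' → j' ≢ j → f k j' ≡ 0))
  row-single {f} up k h = fromPositive (sum-positive {n} term (subst (1 ≤_) (sym h) NP.≤-refl))
    where
    term : Fin n → ℕ
    term j = if does (k F.≤? j) then f k j else 0
    fromPositive : ∃[ j ] (1 ≤ term j) → ∃[ j ] (toℕ k ≤ toℕ j × f k j ≡ 1 × (∀ j' → j' ≢ j → f k j' ≡ 0))
    fromPositive (j , pos) with toℕ k N.≤? toℕ j
    ... | no k≰j = ⊥-elim (NP.<-irrefl refl (NP.<-≤-trans pos (NP.≤-reflexive (if-no (k F.≤? j) k≰j))))
    ... | yes k≤j = j , k≤j , f≡1 , others
      where
      atJ : term j ≡ f k j
      atJ = if-yes (k F.≤? j) k≤j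
      f≡1 : f k j ≡ 1
      f≡1 = NP.≤-antisym (subst₂ _≤_ atJ h (term≤sum term j)) (subst (1 ≤_) atJ pos)
      others : ∀ j' → j' ≢ j → f k j' ≡ 0
      others j' ne with toℕ k N.≤? toℕ j'
      ... | no k≰j' = up k j' (NP.≰⇒> k≰j')
      ... | yes k≤j' = NP.n≤0⇒n≡0 (NP.+-cancelʳ-≤ _ _ _
            (subst₂ _≤_ (cong₂ _+_ (if-yes (k F.≤? j') k≤j') (trans atJ f≡1)) h (twoTerms≤sum term j' j ne)))

  rowSum-fromHook : ∀ {f u k b} → HooksFrom f u → u ≤ toℕ k → colSum f k ≡ 0 →
                    δ (toℕ k) u + δ (toℕ k) m ≡ b → rowSum f k ≡ b
  rowSum-fromHook {f} {u} {k} hk u≤k c≡0 e =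
    trans (hk k u≤k) (trans (cong (λ c → c + (δ (toℕ k) u + δ (toℕ k) m)) c≡0) e)

  -- If row u has no entries strictly between the columns u and w ≤ m, then
  -- all rows strictly between u and w vanish: by induction on the row, such
  -- a row has empty column part and hook value 0.
  rowsBetween-vanish : ∀ {f u w} → Invariant f u → w ≤ m →
                       (∀ r j → toℕ r ≡ u → u < toℕ j → toℕ j < w → f r j ≡ 0) →
                       ∀ i j → u < toℕ i → toℕ i < w → f i j ≡ 0
  rowsBetween-vanish {f} {u} {w} inv w≤m rowU i j = below (toℕ i) i j NP.≤-refl
    where
    open Invariant inv
    below : ∀ t i j → toℕ i ≤ t → u < toℕ i → toℕ i < w → f i j ≡ 0
    below zero i j i≤0 u<i _ = ⊥-elim (NP.<-irrefl refl (NP.<-≤-trans u<i (NP.≤-trans i≤0 z≤n)))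
    below (suc t) i j i≤t+1 u<i i<w with toℕ i N.≤? t
    ... | yes i≤t = below t i j i≤t u<i i<w
    ... | no i≰t = row-vanish upper i rowZero j
      where
      column : ∀ r → toℕ r < toℕ i → f r i ≡ 0
      column r r<i with NP.<-cmp (toℕ r) u
      ... | tri< r<u _ _ = clear r i r<u (NP.<⇒≤ u<i)
      ... | tri≈ _ r≡u _ = rowU r i r≡u u<i i<w
      ... | tri> _ _ u<r = below t r i (NP.≤-pred (NP.<-≤-trans r<i i≤t+1)) u<r (NP.<-trans r<i i<w)
      rowZero : rowSum f i ≡ 0
      rowZero = rowSum-fromHook {f} hooks (NP.<⇒≤ u<i) (colSum-vanish f i column)
        (cong₂ _+_ (δ-≢ (λ e → NP.<-irrefl (sym e) u<i)) (δ-≢ (λ e → NP.<-irrefl e (NP.<-≤-trans i<w w≤m))))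

  lastRow-offDiag : ∀ {f} → Upper f → ∀ j → toℕ j ≢ m → f last j ≡ 0
  lastRow-offDiag up j ne = up last j (subst (toℕ j <_) (sym toℕ-last) (NP.≤∧≢⇒< (toℕ≤m j) ne))

  -- When u = m only row m is left; its hook value is 2, so it is 2 e_mm.
  finish-atLast : ∀ {f} → Invariant f m → AgreesFrom m f (teslerFun m L.[])
  finish-atLast {f} inv i j m≤i
    rewrite idx-unique m<n i (NP.≤-antisym (toℕ≤m i) m≤i) | toℕ-last with toℕ j N.≟ m
  ... | yes j≡m rewrite idx-unique m<n j j≡m | toℕ-last | unit-hit m m = diagonal
    where
    open Invariant inv
    column : colSum f last ≡ 0
    column = colSum-vanish f last (λ r r<m → clear r last (subst (toℕ r <_) toℕ-last r<m) (NP.≤-reflexive (sym toℕ-last)))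
    diagonal : f last last ≡ 2
    diagonal = trans (sym (rowSum-last f))
      (rowSum-fromHook {f} hooks (NP.≤-reflexive (sym toℕ-last)) column (cong₂ _+_ (δ-≡ toℕ-last) (δ-≡ toℕ-last)))
  ... | no j≢m = trans (lastRow-offDiag (Invariant.upper inv) j j≢m)
                       (sym (cong₂ _+_ (unit-offCol m m m (toℕ j) j≢m) (unit-offCol m m m (toℕ j) j≢m)))

  -- Row u < m has hook value 1 and empty column part, so it is a single 1.
  sourceRow : ∀ {f u} → Invariant f u → (u<n : u < n) → u < m →
              ∃[ j ] (u ≤ toℕ j × f (idx u<n) j ≡ 1 × (∀ j' → j' ≢ j → f (idx u<n) j' ≡ 0))
  sourceRow {f} {u} inv u<n u<m = relabel (row-single upper (idx u<n) rowOne)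
    where
    open Invariant inv
    u≤ku : u ≤ toℕ (idx u<n)
    u≤ku = NP.≤-reflexive (sym (toℕ-idx u<n))
    rowOne : rowSum f (idx u<n) ≡ 1
    rowOne = rowSum-fromHook {f} hooks u≤ku
      (colSum-vanish f (idx u<n) (λ i i<u → clear i (idx u<n) (subst (toℕ i <_) (toℕ-idx u<n) i<u) u≤ku))
      (cong₂ _+_ (δ-≡ (toℕ-idx u<n)) (δ-≢ (λ e → NP.<-irrefl (trans (sym (toℕ-idx u<n)) e) u<m)))
    relabel : ∃[ j ] (toℕ (idx u<n) ≤ toℕ j × f (idx u<n) j ≡ 1 × (∀ j' → j' ≢ j → f (idx u<n) j' ≡ 0)) →
            ∃[ j ] (u ≤ toℕ j × f (idx u<n) j ≡ 1 × (∀ j' → j' ≢ j → f (idx u<n) j' ≡ 0))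
    relabel (j , ku≤j , rest) = j , subst (_≤ toℕ j) (toℕ-idx u<n) ku≤j , rest

  -- If the single 1 of row u < m is on the diagonal, the path stops at u:
  -- rows strictly between u and m vanish and row m is a diagonal 1.
  module Stop {f u} (inv : Invariant f u) (u<n : u < n) (u<m : u < m)
              (f≡1 : f (idx u<n) (idx u<n) ≡ 1) (others : ∀ j → j ≢ idx u<n → f (idx u<n) j ≡ 0) where
    open Invariant inv

    u≢m : u ≢ m
    u≢m e = NP.<-irrefl e u<m
    toℕ-atU : ∀ {j} → j ≡ idx u<n → toℕ j ≡ u
    toℕ-atU e = trans (cong toℕ e) (toℕ-idx u<n)
    rowU : ∀ r j → toℕ r ≡ u → u < toℕ j → toℕ j < m → f r j ≡ 0
    rowU r j r≡u u<j _ rewrite idx-unique u<n r r≡u = others j (λ e → NP.<-irrefl (sym (toℕ-atU e)) u<j)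
    between : ∀ i j → u < toℕ i → toℕ i < m → f i j ≡ 0
    between = rowsBetween-vanish inv NP.≤-refl rowU
    column : ∀ r → toℕ r < toℕ last → f r last ≡ 0
    column r r<m with NP.<-cmp (toℕ r) u
    ... | tri< r<u _ _ = clear r last r<u (subst (u ≤_) (sym toℕ-last) (NP.<⇒≤ u<m))
    ... | tri≈ _ r≡u _ rewrite idx-unique u<n r r≡u = others last (λ e → u≢m (trans (sym (toℕ-atU e)) toℕ-last))
    ... | tri> _ _ u<r = between r last u<r (subst (toℕ r <_) toℕ-last r<m)
    lastDiagonal : f last last ≡ 1
    lastDiagonal = trans (sym (rowSum-last f))
      (rowSum-fromHook {f} hooks (subst (u ≤_) (sym toℕ-last) (NP.<⇒≤ u<m)) (colSum-vanish f last column)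
        (cong₂ _+_ (δ-≢ (λ e → u≢m (trans (sym e) toℕ-last))) (δ-≡ toℕ-last)))
    rowU-agrees : ∀ j → f (idx u<n) j ≡ teslerFun u L.[] u (toℕ j)
    rowU-agrees j with toℕ j N.≟ u
    ... | yes j≡u rewrite idx-unique u<n j j≡u | toℕ-idx u<n | unit-hit u u | unit-offRow m m u u u≢m = f≡1
    ... | no j≢u = trans (others j (λ e → j≢u (toℕ-atU e)))
                         (sym (cong₂ _+_ (unit-offCol u u u (toℕ j) j≢u) (unit-offRow m m u (toℕ j) u≢m)))
    lastRow-agrees : ∀ j → f last j ≡ teslerFun u L.[] m (toℕ j)
    lastRow-agrees j with toℕ j N.≟ m
    ... | yes j≡m rewrite idx-unique m<n j j≡m | toℕ-last | unit-hit m m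
                        | unit-offRow u u m m (λ e → u≢m (sym e)) = lastDiagonal
    ... | no j≢m = trans (lastRow-offDiag upper j j≢m)
                         (sym (cong₂ _+_ (unit-offRow u u m (toℕ j) (λ e → u≢m (sym e))) (unit-offCol m m m (toℕ j) j≢m)))

    agrees : AgreesFrom u f (teslerFun u L.[])
    agrees i j u≤i = byRow (NP.<-cmp (toℕ i) u)
      where
      byRow : Tri (toℕ i < u) (toℕ i ≡ u) (u < toℕ i) → f i j ≡ teslerFun u L.[] (toℕ i) (toℕ j)
      byRow (tri< i<u _ _) = ⊥-elim (NP.<⇒≱ i<u u≤i)
      byRow (tri≈ _ i≡u _) rewrite idx-unique u<n i i≡u | toℕ-idx u<n = rowU-agrees j
      byRow (tri> _ _ u<i) with toℕ i N.≟ m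
      ... | yes i≡m rewrite idx-unique m<n i i≡m | toℕ-last = lastRow-agrees j
      ... | no i≢m = trans (between i j u<i (NP.≤∧≢⇒< (toℕ≤m i) i≢m))
                           (sym (cong₂ _+_ (unit-offRow u u (toℕ i) (toℕ j) (λ e → NP.<-irrefl (sym e) u<i))
                                           (unit-offRow m m (toℕ i) (toℕ j) i≢m)))

  -- If the single 1 of row u < m sits in column v > u, the path continues to v:
  -- g = f - e_uv satisfies the invariant at v, and a description of g from
  -- row v on yields one of f from row u on.
  module Advance {f u} (inv : Invariant f u) (u<n : u < n) (u<m : u < m)
                 (v : Fin n) (u<v : u < toℕ v) (f≡1 : f (idx u<n) v ≡ 1)
                 (others : ∀ j → j ≢ v → f (idx u<n) j ≡ 0) where
    open Invariant inv

    edge : ℕ → ℕ → ℕ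
    edge = unit u (toℕ v)

    g : Entries
    g i j = f i j ∸ edge (toℕ i) (toℕ j)

    rowU-isEdge : ∀ i j → toℕ i ≡ u → f i j ≡ edge (toℕ i) (toℕ j)
    rowU-isEdge i j i≡u with toℕ j N.≟ toℕ v
    ... | yes j≡v rewrite idx-unique u<n i i≡u | FP.toℕ-injective j≡v | toℕ-idx u<n | unit-hit u (toℕ v) = f≡1
    ... | no j≢v rewrite idx-unique u<n i i≡u =
      trans (others j (λ e → j≢v (cong toℕ e))) (sym (unit-offCol u (toℕ v) (toℕ (idx u<n)) (toℕ j) j≢v))

    edge≤f : ∀ i j → edge (toℕ i) (toℕ j) ≤ f i j
    edge≤f i j with toℕ i N.≟ u
    ... | yes i≡u = NP.≤-reflexive (sym (rowU-isEdge i j i≡u))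
    ... | no i≢u = subst (_≤ f i j) (sym (unit-offRow u (toℕ v) (toℕ i) (toℕ j) i≢u)) z≤n

    split : ∀ i j → f i j ≡ g i j + edge (toℕ i) (toℕ j)
    split i j = sym (NP.m∸n+n≡m (edge≤f i j))

    g-zero : ∀ {i j} → f i j ≡ 0 → g i j ≡ 0
    g-zero {i} {j} e rewrite e = NP.0∸n≡0 (edge (toℕ i) (toℕ j))

    g-rowU : ∀ i j → toℕ i ≡ u → g i j ≡ 0
    g-rowU i j i≡u = trans (cong (_∸ edge (toℕ i) (toℕ j)) (rowU-isEdge i j i≡u)) (NP.n∸n≡0 (edge (toℕ i) (toℕ j)))

    between : ∀ i j → u < toℕ i → toℕ i < toℕ v → f i j ≡ 0
    between = rowsBetween-vanish inv (toℕ≤m v) rowU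
      where
      rowU : ∀ r j → toℕ r ≡ u → u < toℕ j → toℕ j < toℕ v → f r j ≡ 0
      rowU r j r≡u _ j<v rewrite idx-unique u<n r r≡u = others j (λ e → NP.<-irrefl (cong toℕ e) j<v)

    g-before : ∀ i j → u ≤ toℕ i → toℕ i < toℕ v → g i j ≡ 0
    g-before i j u≤i i<v with NP.<-cmp (toℕ i) u
    ... | tri< i<u _ _ = ⊥-elim (NP.<⇒≱ i<u u≤i)
    ... | tri≈ _ i≡u _ = g-rowU i j i≡u
    ... | tri> _ _ u<i = g-zero (between i j u<i i<v)

    invariant : Invariant g (toℕ v)
    invariant = record { upper = λ i j j<i → g-zero (upper i j j<i) ; clear = cleared ; hooks = hooksV }
      where
      cleared : ClearAbove g (toℕ v)
      cleared i j i<v v≤j with NP.<-cmp (toℕ i) u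
      ... | tri< i<u _ _ = g-zero (clear i j i<u (NP.≤-trans (NP.<⇒≤ u<v) v≤j))
      ... | tri≈ _ i≡u _ = g-rowU i j i≡u
      ... | tri> _ _ u<i = g-zero (between i j u<i i<v)
      hooksV : HooksFrom g (toℕ v)
      hooksV k v≤k = begin
        rowSum g k                                      ≡⟨ sym (NP.+-identityʳ _) ⟩
        rowSum g k + 0                                  ≡⟨ cong (λ z → rowSum g k + z) (sym δku≡0) ⟩
        rowSum g k + δ (toℕ k) u                        ≡⟨ sym rowSplit ⟩
        rowSum f k                                      ≡⟨ hooks k (NP.≤-trans (NP.<⇒≤ u<v) v≤k) ⟩
        colSum f k + (δ (toℕ k) u + δ (toℕ k) m)        ≡⟨ cong₂ _+_ colSplit (cong (_+ δ (toℕ k) m) δku≡0) ⟩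
        (colSum g k + δ (toℕ k) (toℕ v)) + δ (toℕ k) m  ≡⟨ NP.+-assoc (colSum g k) _ _ ⟩
        colSum g k + (δ (toℕ k) (toℕ v) + δ (toℕ k) m)  ∎
        where
        open ≡-Reasoning
        δku≡0 : δ (toℕ k) u ≡ 0
        δku≡0 = δ-≢ (λ e → NP.<-irrefl (sym e) (NP.<-≤-trans u<v v≤k))
        rowSplit : rowSum f k ≡ rowSum g k + δ (toℕ k) u
        rowSplit = trans (rowSum-cong split k)
          (trans (rowSum-+ g (lift edge) k) (cong (λ z → rowSum g k + z) (rowSum-unit u (toℕ v) (NP.<⇒≤ u<v) (FP.toℕ<n v) k)))
        colSplit : colSum f k ≡ colSum g k + δ (toℕ k) (toℕ v)
        colSplit = trans (colSum-cong split k)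
          (trans (colSum-+ g (lift edge) k) (cong (λ z → colSum g k + z) (colSum-unit u (toℕ v) u<v (FP.toℕ<n v) k)))

    extend : ∀ {vs} → Chain n (toℕ v) vs → AgreesFrom (toℕ v) g (teslerFun (toℕ v) vs) →
             AgreesFrom u f (teslerFun u (toℕ v L.∷ vs))
    extend {vs} c agrees i j u≤i with toℕ i N.<? toℕ v
    ... | yes i<v = begin
      f i j                                       ≡⟨ split i j ⟩
      g i j + edge (toℕ i) (toℕ j)                ≡⟨ cong (_+ edge (toℕ i) (toℕ j)) (g-before i j u≤i i<v) ⟩
      edge (toℕ i) (toℕ j)                        ≡⟨ sym (trans (NP.+-identityʳ _) (NP.+-identityʳ _)) ⟩
      (edge (toℕ i) (toℕ j) + 0) + 0              ≡⟨ sym (cong₂ (λ p l → (edge (toℕ i) (toℕ j) + p) + l) pathAbove lastBelow) ⟩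
      teslerFun u (toℕ v L.∷ vs) (toℕ i) (toℕ j)  ∎
      where
      open ≡-Reasoning
      pathAbove : pathFun (toℕ v) vs (toℕ i) (toℕ j) ≡ 0
      pathAbove = path-rowsAbove c (toℕ j) i<v
      lastBelow : unit m m (toℕ i) (toℕ j) ≡ 0
      lastBelow = unit-offRow m m (toℕ i) (toℕ j) (λ e → NP.<-irrefl e (NP.<-≤-trans i<v (toℕ≤m v)))
    ... | no i≮v = begin
      f i j                                           ≡⟨ split i j ⟩
      g i j + edge (toℕ i) (toℕ j)                    ≡⟨ cong (_+ edge (toℕ i) (toℕ j)) (agrees i j (NP.≮⇒≥ i≮v)) ⟩
      teslerFun (toℕ v) vs (toℕ i) (toℕ j) + edge (toℕ i) (toℕ j)
                                                      ≡⟨ rearrange (pathFun (toℕ v) vs (toℕ i) (toℕ j)) (unit m m (toℕ i) (toℕ j)) _ ⟩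
      teslerFun u (toℕ v L.∷ vs) (toℕ i) (toℕ j)      ∎
      where
      open ≡-Reasoning
      rearrange : ∀ p l e → (p + l) + e ≡ (e + p) + l
      rearrange = solve-∀

  -- Peeling off the path row by row; the fuel d bounds the number of
  -- remaining rows, m ≤ u + d.
  peel : ∀ d {f u} → m ≤ u + d → u ≤ m → Invariant f u →
         ∃[ vs ] (Chain n u vs × AgreesFrom u f (teslerFun u vs))
  peel d {f} {u} m≤u+d u≤m inv with u N.≟ m
  ... | yes refl = L.[] , end m<n , finish-atLast inv
  peel zero {f} {u} m≤u+0 u≤m inv | no u≢m =
    ⊥-elim (u≢m (NP.≤-antisym u≤m (subst (m ≤_) (NP.+-identityʳ u) m≤u+0)))
  peel (suc d) {f} {u} m≤u+d u≤m inv | no u≢m = continue (sourceRow inv u<n u<m)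
    where
    u<m : u < m
    u<m = NP.≤∧≢⇒< u≤m u≢m
    u<n : u < n
    u<n = NP.<-trans u<m m<n
    continue : ∃[ v ] (u ≤ toℕ v × f (idx u<n) v ≡ 1 × (∀ j → j ≢ v → f (idx u<n) j ≡ 0)) →
               ∃[ vs ] (Chain n u vs × AgreesFrom u f (teslerFun u vs))
    continue (v , u≤v , f≡1 , others) with toℕ v N.≟ u
    ... | yes v≡u with idx-unique u<n v v≡u
    ...   | refl = L.[] , end u<n , Stop.agrees inv u<n u<m f≡1 others
    continue (v , u≤v , f≡1 , others) | no v≢u = advanceTo v (NP.≤∧≢⇒< u≤v (λ e → v≢u (sym e))) f≡1 others
      where
      advanceTo : ∀ v → u < toℕ v → f (idx u<n) v ≡ 1 → (∀ j → j ≢ v → f (idx u<n) j ≡ 0) →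
                  ∃[ vs ] (Chain n u vs × AgreesFrom u f (teslerFun u vs))
      advanceTo v u<v f≡1 others
        with peel d (NP.≤-trans m≤u+d (subst (_≤ toℕ v + d) (sym (NP.+-suc u d)) (NP.+-monoˡ-≤ d u<v)))
                    (toℕ≤m v) (Advance.invariant inv u<n u<m v u<v f≡1 others)
      ... | vs , c , agrees = toℕ v L.∷ vs , step u<v c , Advance.extend inv u<n u<m v u<v f≡1 others c agrees

  tesler⇒invariant : 1 ≤ m → ∀ A → Tesler (aVec n) A → Invariant (entry A) 0
  tesler⇒invariant 1≤m A (upper , hooksA) = record { upper = upper ; clear = λ i j () ; hooks = hooks0 }
    where
    hooks0 : HooksFrom (entry A) 0
    hooks0 k _ = trans (hookEq⇒ (rowSum (entry A) k) (V.lookup (aVec n) k) (colSum (entry A) k)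
                          (trans (sym (hook≡rowSum-colSum A k)) (hooksA k)))
                       (cong (λ b → colSum (entry A) k + b) (aVec≡δ 1≤m k))

  tesler⇒path : 1 ≤ m → ∀ A → Tesler (aVec n) A → ∃[ vs ] (Chain n 0 vs × A ≡ fromFun (teslerFun 0 vs))
  tesler⇒path 1≤m A t with peel m NP.≤-refl z≤n (tesler⇒invariant 1≤m A t)
  ... | vs , c , agrees = vs , c , matrix-ext A (teslerFun 0 vs) (λ i j → agrees i j z≤n)

  -- elements S o lists o + t for the members t of S, in increasing order
  elements : ∀ {k} → Subset k → ℕ → List ℕ
  elements V.[] o = L.[]
  elements (inside V.∷ S) o = o L.∷ elements S (suc o)
  elements (outside V.∷ S) o = elements S (suc o)

  elements-chain : ∀ {k} (S : Subset k) o u → u < o → o + k ≤ n → Chain n u (elements S o)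
  elements-chain V.[] o u u<o o+0≤n = end (NP.<-≤-trans u<o (subst (_≤ n) (NP.+-identityʳ o) o+0≤n))
  elements-chain {suc k} (inside V.∷ S) o u u<o o+k≤n =
    step u<o (elements-chain S (suc o) o (NP.n<1+n o) (subst (_≤ n) (NP.+-suc o k) o+k≤n))
  elements-chain {suc k} (outside V.∷ S) o u u<o o+k≤n =
    elements-chain S (suc o) u (NP.m≤n⇒m≤1+n u<o) (subst (_≤ n) (NP.+-suc o k) o+k≤n)

  elements-empty : ∀ k o → elements (V.replicate k outside) o ≡ L.[]
  elements-empty zero o = refl
  elements-empty (suc k) o = elements-empty k (suc o)

  chain⇒subset : ∀ k o {u vs} → Chain n u vs → o ≤ suc u → n ≤ o + k → ∃[ S ] (elements {k} S o ≡ vs)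
  chain⇒subset k o {u} {L.[]} c o≤u+1 n≤o+k = V.replicate k outside , elements-empty k o
  chain⇒subset zero o {u} {v L.∷ vs} (step u<v c) o≤u+1 n≤o+0 =
    ⊥-elim (NP.<-irrefl refl (NP.<-≤-trans (chain-bound c)
      (NP.≤-trans n≤o+0 (NP.≤-trans (NP.≤-reflexive (NP.+-identityʳ o)) (NP.≤-trans o≤u+1 u<v)))))
  chain⇒subset (suc k) o {u} {v L.∷ vs} (step u<v c) o≤u+1 n≤o+k with v N.≟ o
  ... | yes refl with chain⇒subset k (suc v) c NP.≤-refl (subst (n ≤_) (NP.+-suc v k) n≤o+k)
  ...   | S , e = (inside V.∷ S) , cong (v L.∷_) e
  chain⇒subset (suc k) o {u} {v L.∷ vs} (step u<v c) o≤u+1 n≤o+k | no v≢o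
    with chain⇒subset k (suc o) {o} (step (NP.≤∧≢⇒< (NP.≤-trans o≤u+1 u<v) (λ e → v≢o (sym e))) c)
                      NP.≤-refl (subst (n ≤_) (NP.+-suc o k) n≤o+k)
  ... | S , e = (outside V.∷ S) , e

  occurrences-below : ∀ {k} (S : Subset k) o x → x < o → occurrences x (elements S o) ≡ 0
  occurrences-below V.[] o x x<o = refl
  occurrences-below (inside V.∷ S) o x x<o rewrite δ-≢ {x} {o} (λ e → NP.<-irrefl e x<o) =
    occurrences-below S (suc o) x (NP.m≤n⇒m≤1+n x<o)
  occurrences-below (outside V.∷ S) o x x<o = occurrences-below S (suc o) x (NP.m≤n⇒m≤1+n x<o)

  occurrences-elements : ∀ {k} (S : Subset k) o (t : Fin k) →
                         occurrences (o + toℕ t) (elements S o) ≡ (if V.lookup S t then 1 else 0)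
  occurrences-elements (inside V.∷ S) o F.zero rewrite NP.+-identityʳ o | δ-refl o =
    cong suc (occurrences-below S (suc o) o (NP.n<1+n o))
  occurrences-elements (outside V.∷ S) o F.zero rewrite NP.+-identityʳ o =
    occurrences-below S (suc o) o (NP.n<1+n o)
  occurrences-elements (inside V.∷ S) o (F.suc t)
    rewrite NP.+-suc o (toℕ t) | δ-≢ {suc (o + toℕ t)} {o} (λ e → NP.<-irrefl (sym e) (s≤s (NP.m≤m+n o (toℕ t)))) =
    occurrences-elements S (suc o) t
  occurrences-elements (outside V.∷ S) o (F.suc t) rewrite NP.+-suc o (toℕ t) = occurrences-elements S (suc o) t

  length-elements : ∀ {k} (S : Subset k) o → L.length (elements S o) ≡ ∣ S ∣
  length-elements V.[] o = refl
  length-elements (inside V.∷ S) o = cong suc (length-elements S (suc o))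
  length-elements (outside V.∷ S) o = length-elements S (suc o)

  subsetMatrix : Subset m → Matrix n
  subsetMatrix S = fromFun (teslerFun 0 (elements S 1))

  subsetChain : ∀ S → Chain n 0 (elements S 1)
  subsetChain S = elements-chain S 1 0 (s≤s z≤n) NP.≤-refl

  colSum-subsetMatrix : ∀ S (t : Fin m) → colSum (entry (subsetMatrix S)) (F.suc t) ≡ (if V.lookup S t then 1 else 0)
  colSum-subsetMatrix S t = begin
    colSum (entry (subsetMatrix S)) (F.suc t)          ≡⟨ colSum-cong (entry-fromFun (teslerFun 0 (elements S 1))) (F.suc t) ⟩
    colSum (lift (teslerFun 0 (elements S 1))) (F.suc t) ≡⟨ colSum-tesler (subsetChain S) (F.suc t) ⟩
    occurrences (1 + toℕ t) (elements S 1) + 0         ≡⟨ NP.+-identityʳ _ ⟩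
    occurrences (1 + toℕ t) (elements S 1)             ≡⟨ occurrences-elements S 1 t ⟩
    (if V.lookup S t then 1 else 0)                    ∎
    where open ≡-Reasoning

  subsetOf : Matrix n → Subset m
  subsetOf A = V.tabulate (λ t → 1 N.≤ᵇ colSum (entry A) (F.suc t))

  subsetOf-subsetMatrix : ∀ S → subsetOf (subsetMatrix S) ≡ S
  subsetOf-subsetMatrix S =
    trans (VP.tabulate-cong (λ t → trans (cong (1 N.≤ᵇ_) (colSum-subsetMatrix S t)) (readBit (V.lookup S t))))
          (VP.tabulate∘lookup S)
    where
    readBit : ∀ b → (1 N.≤ᵇ (if b then 1 else 0)) ≡ b
    readBit true = refl
    readBit false = refl

  subsetMatrix-injective : ∀ {T S} → subsetMatrix T ≡ subsetMatrix S → T ≡ S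
  subsetMatrix-injective {T} {S} e =
    trans (sym (subsetOf-subsetMatrix T)) (trans (cong subsetOf e) (subsetOf-subsetMatrix S))

  tesler⇒subsetMatrix : 1 ≤ m → ∀ A → Tesler (aVec n) A → A ≡ subsetMatrix (subsetOf A)
  tesler⇒subsetMatrix 1≤m A t with tesler⇒path 1≤m A t
  ... | vs , c , A≡path with chain⇒subset m 1 c NP.≤-refl NP.≤-refl
  ...   | S , refl = trans A≡path (cong subsetMatrix (sym (trans (cong subsetOf A≡path) (subsetOf-subsetMatrix S))))

  rankFun : Entries → ℕ
  rankFun f = sum {n} (λ i → sum {n} (λ j → if does (i F.<? j) then f i j else 0))

  rank≡rankFun : ∀ A → rank A ≡ rankFun (entry A)
  rank≡rankFun A = trans (sumFin≡sum {n} _)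
    (sum-cong-≗ (λ i → sumFin≡sum {n} (λ j → if does (i F.<? j) then entry A i j else 0)))

  rankFun-cong : ∀ {f g} → (∀ i j → f i j ≡ g i j) → rankFun f ≡ rankFun g
  rankFun-cong e = sum-cong-≗ (λ i → sum-cong-≗ (λ j → cong (λ x → if does (i F.<? j) then x else 0) (e i j)))

  rankFun-+ : ∀ f g → rankFun (λ i j → f i j + g i j) ≡ rankFun f + rankFun g
  rankFun-+ f g = trans
    (sum-cong-≗ (λ i → trans (sum-cong-≗ (λ j → if-+ (does (i F.<? j)) (f i j) (g i j)))
                             (∑-distrib-+ (λ j → if does (i F.<? j) then f i j else 0) (λ j → if does (i F.<? j) then g i j else 0))))
    (∑-distrib-+ (λ i → sum {n} (λ j → if does (i F.<? j) then f i j else 0))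
                 (λ i → sum {n} (λ j → if does (i F.<? j) then g i j else 0)))

  rankFun-unit : ∀ u v → u < v → v < n → rankFun (lift (unit u v)) ≡ 1
  rankFun-unit u v u<v v<n =
    trans (sum-single {n} (λ i → sum {n} (λ j → if does (i F.<? j) then unit u v (toℕ i) (toℕ j) else 0)) (idx u<n) otherRows)
    (trans (sum-single {n} (λ j → if does (idx u<n F.<? j) then unit u v (toℕ (idx u<n)) (toℕ j) else 0) (idx v<n) otherCols)
      atUV)
    where
    u<n : u < n
    u<n = NP.<-trans u<v v<n
    otherRows : ∀ i → i ≢ idx u<n → sum {n} (λ j → if does (i F.<? j) then unit u v (toℕ i) (toℕ j) else 0) ≡ 0
    otherRows i ne = sum-zero {n} _ (λ j → if-zero (does (i F.<? j)) (unit-offRow u v (toℕ i) (toℕ j) (≢idx u<n i ne)))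
    otherCols : ∀ j → j ≢ idx v<n → (if does (idx u<n F.<? j) then unit u v (toℕ (idx u<n)) (toℕ j) else 0) ≡ 0
    otherCols j ne = if-zero (does (idx u<n F.<? j)) (unit-offCol u v (toℕ (idx u<n)) (toℕ j) (≢idx v<n j ne))
    atUV : (if does (idx u<n F.<? idx v<n) then unit u v (toℕ (idx u<n)) (toℕ (idx v<n)) else 0) ≡ 1
    atUV = trans (if-yes (idx u<n F.<? idx v<n) (subst₂ _<_ (sym (toℕ-idx u<n)) (sym (toℕ-idx v<n)) u<v))
                 (trans (cong₂ (unit u v) (toℕ-idx u<n) (toℕ-idx v<n)) (unit-hit u v))

  rankFun-unitDiag : ∀ u → rankFun (lift (unit u u)) ≡ 0
  rankFun-unitDiag u = sum-zero {n} _ (λ i → sum-zero {n} (λ j → if does (i F.<? j) then unit u u (toℕ i) (toℕ j) else 0) (vanish i))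
    where
    vanish : ∀ i j → (if does (i F.<? j) then unit u u (toℕ i) (toℕ j) else 0) ≡ 0
    vanish i j with toℕ i N.≟ toℕ j
    ... | no ne = if-zero (does (i F.<? j)) (unit-offDiag u ne)
    ... | yes e = if-no (i F.<? j) (λ lt → NP.<-irrefl e lt)

  rankFun-path : ∀ {u vs} → Chain n u vs → rankFun (lift (pathFun u vs)) ≡ L.length vs
  rankFun-path {u} (end _) = rankFun-unitDiag u
  rankFun-path {u} {v L.∷ vs} (step u<v c) =
    trans (rankFun-+ (lift (unit u v)) (lift (pathFun v vs))) (cong₂ _+_ (rankFun-unit u v u<v (chain-bound c)) (rankFun-path c))

  rank-subsetMatrix : ∀ S → rank (subsetMatrix S) ≡ ∣ S ∣
  rank-subsetMatrix S = begin
    rank (subsetMatrix S)                                   ≡⟨ rank≡rankFun (subsetMatrix S) ⟩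
    rankFun (entry (subsetMatrix S))                        ≡⟨ rankFun-cong (entry-fromFun (teslerFun 0 (elements S 1))) ⟩
    rankFun (lift (teslerFun 0 (elements S 1)))             ≡⟨ rankFun-+ (lift (pathFun 0 (elements S 1))) (lift (unit m m)) ⟩
    rankFun (lift (pathFun 0 (elements S 1))) + rankFun (lift (unit m m))
                                                            ≡⟨ cong₂ _+_ (rankFun-path (subsetChain S)) (rankFun-unitDiag m) ⟩
    L.length (elements S 1) + 0                             ≡⟨ NP.+-identityʳ _ ⟩
    L.length (elements S 1)                                 ≡⟨ length-elements S 1 ⟩
    ∣ S ∣                                                   ∎
    where open ≡-Reasoning

  -- A cover moves one unit of mass: A covers B when A + e_{p₃} = B + e_{p₁} + e_{p₂}
  -- for the three distinct positions p₁, p₂, p₃ of the definition.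

  Position : Set
  Position = Fin n × Fin n

  unitAt : Position → Entries
  unitAt (x , y) r s = unit (toℕ x) (toℕ y) (toℕ r) (toℕ s)

  unitAt-hit : ∀ x y → unitAt (x , y) x y ≡ 1
  unitAt-hit x y = unit-hit (toℕ x) (toℕ y)

  unitAt-miss : ∀ {x y r s} → ¬ (r ≡ x × s ≡ y) → unitAt (x , y) r s ≡ 0
  unitAt-miss {x} {y} {r} {s} h with r F.≟ x
  ... | no r≢x = unit-offRow (toℕ x) (toℕ y) (toℕ r) (toℕ s) (λ e → r≢x (FP.toℕ-injective e))
  ... | yes r≡x = unit-offCol (toℕ x) (toℕ y) (toℕ r) (toℕ s) (λ e → h (r≡x , FP.toℕ-injective e))

  Distinct : Position → Position → Set
  Distinct (x₁ , y₁) (x₂ , y₂) = ¬ (x₁ ≡ x₂ × y₁ ≡ y₂)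

  distinct-sym : ∀ {p q} → Distinct p q → Distinct q p
  distinct-sym h (a , b) = h (sym a , sym b)

  Distinct₃ : Position → Position → Position → Set
  Distinct₃ p₁ p₂ p₃ = Distinct p₁ p₂ × Distinct p₁ p₃ × Distinct p₂ p₃

  <⇒≢ : ∀ {i j : Fin n} → i F.< j → i ≢ j
  <⇒≢ i<j e = NP.<-irrefl (cong toℕ e) i<j

  triangle-distinct : ∀ {i j k : Fin n} → i F.< j → j F.< k → Distinct₃ (i , j) (j , k) (i , k)
  triangle-distinct i<j j<k =
    (λ p → <⇒≢ i<j (proj₁ p)) , (λ p → <⇒≢ j<k (proj₂ p)) , (λ p → <⇒≢ i<j (sym (proj₁ p)))

  diagonal-distinct : ∀ {i j : Fin n} → i F.< j → Distinct₃ (i , j) (j , j) (i , i)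
  diagonal-distinct i<j =
    (λ p → <⇒≢ i<j (proj₁ p)) , (λ p → <⇒≢ i<j (sym (proj₂ p))) , (λ p → <⇒≢ i<j (sym (proj₁ p)))

  MoveEquation : Entries → Entries → Position → Position → Position → Set
  MoveEquation a b p₁ p₂ p₃ = ∀ r s → a r s + unitAt p₃ r s ≡ (b r s + unitAt p₁ r s) + unitAt p₂ r s

  MoveConditions : Matrix n → Matrix n → Position → Position → Position → Set
  MoveConditions A B (x₁ , y₁) (x₂ , y₂) (x₃ , y₃) =
    entry A x₁ y₁ ≡ entry B x₁ y₁ + 1 × entry A x₂ y₂ ≡ entry B x₂ y₂ + 1 ×
    entry A x₃ y₃ + 1 ≡ entry B x₃ y₃ × OthersEqual₃ A B (x₁ , y₁) (x₂ , y₂) (x₃ , y₃)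

  equation⇒conditions : ∀ A B p₁ p₂ p₃ → Distinct₃ p₁ p₂ p₃ →
                        MoveEquation (entry A) (entry B) p₁ p₂ p₃ → MoveConditions A B p₁ p₂ p₃
  equation⇒conditions A B (x₁ , y₁) (x₂ , y₂) (x₃ , y₃) (d₁₂ , d₁₃ , d₂₃) eq = at₁ , at₂ , at₃ , elsewhere
    where
    at₁ : entry A x₁ y₁ ≡ entry B x₁ y₁ + 1
    at₁ with eq x₁ y₁
    ... | e rewrite unitAt-miss {x₃} {y₃} {x₁} {y₁} d₁₃ | unitAt-hit x₁ y₁ | unitAt-miss {x₂} {y₂} {x₁} {y₁} d₁₂ =
      trans (sym (NP.+-identityʳ _)) (trans e (NP.+-identityʳ _))
    at₂ : entry A x₂ y₂ ≡ entry B x₂ y₂ + 1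
    at₂ with eq x₂ y₂
    ... | e rewrite unitAt-miss {x₃} {y₃} {x₂} {y₂} d₂₃ | unitAt-miss {x₁} {y₁} {x₂} {y₂} (distinct-sym d₁₂)
                  | unitAt-hit x₂ y₂ =
      trans (sym (NP.+-identityʳ _)) (trans e (cong (_+ 1) (NP.+-identityʳ _)))
    at₃ : entry A x₃ y₃ + 1 ≡ entry B x₃ y₃
    at₃ with eq x₃ y₃
    ... | e rewrite unitAt-hit x₃ y₃ | unitAt-miss {x₁} {y₁} {x₃} {y₃} (distinct-sym d₁₃)
                  | unitAt-miss {x₂} {y₂} {x₃} {y₃} (distinct-sym d₂₃) =
      trans e (trans (NP.+-identityʳ _) (NP.+-identityʳ _))
    elsewhere : OthersEqual₃ A B (x₁ , y₁) (x₂ , y₂) (x₃ , y₃)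
    elsewhere r s n₁ n₂ n₃ with eq r s
    ... | e rewrite unitAt-miss {x₃} {y₃} {r} {s} n₃ | unitAt-miss {x₁} {y₁} {r} {s} n₁ | unitAt-miss {x₂} {y₂} {r} {s} n₂ =
      trans (sym (NP.+-identityʳ _)) (trans e (trans (NP.+-identityʳ _) (NP.+-identityʳ _)))

  conditions⇒equation : ∀ A B p₁ p₂ p₃ → Distinct₃ p₁ p₂ p₃ →
                        MoveConditions A B p₁ p₂ p₃ → MoveEquation (entry A) (entry B) p₁ p₂ p₃
  conditions⇒equation A B (x₁ , y₁) (x₂ , y₂) (x₃ , y₃) (d₁₂ , d₁₃ , d₂₃) (at₁ , at₂ , at₃ , elsewhere) r s
    with (r F.≟ x₁) ×-dec (s F.≟ y₁) | (r F.≟ x₂) ×-dec (s F.≟ y₂) | (r F.≟ x₃) ×-dec (s F.≟ y₃)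
  ... | yes (refl , refl) | _ | _
    rewrite unitAt-miss {x₃} {y₃} {x₁} {y₁} d₁₃ | unitAt-hit x₁ y₁ | unitAt-miss {x₂} {y₂} {x₁} {y₁} d₁₂ | at₁ = refl
  ... | no _ | yes (refl , refl) | _
    rewrite unitAt-miss {x₃} {y₃} {x₂} {y₂} d₂₃ | unitAt-miss {x₁} {y₁} {x₂} {y₂} (distinct-sym d₁₂) | unitAt-hit x₂ y₂ | at₂ =
      trans (NP.+-identityʳ _) (cong (_+ 1) (sym (NP.+-identityʳ _)))
  ... | no _ | no _ | yes (refl , refl)
    rewrite unitAt-hit x₃ y₃ | unitAt-miss {x₁} {y₁} {x₃} {y₃} (distinct-sym d₁₃)
          | unitAt-miss {x₂} {y₂} {x₃} {y₃} (distinct-sym d₂₃) | sym at₃ =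
      sym (trans (NP.+-identityʳ _) (NP.+-identityʳ _))
  ... | no n₁ | no n₂ | no n₃
    rewrite unitAt-miss {x₃} {y₃} {r} {s} n₃ | unitAt-miss {x₁} {y₁} {r} {s} n₁ | unitAt-miss {x₂} {y₂} {r} {s} n₂
          | elsewhere r s n₁ n₂ n₃ = sym (NP.+-identityʳ _)

  colSum-move : ∀ {a b p₁ p₂ p₃} → MoveEquation a b p₁ p₂ p₃ → ∀ k →
                colSum a k + colSum (unitAt p₃) k ≡ (colSum b k + colSum (unitAt p₁) k) + colSum (unitAt p₂) k
  colSum-move {a} {b} {p₁} {p₂} {p₃} eq k =
    trans (sym (colSum-+ a (unitAt p₃) k))
      (trans (colSum-cong eq k)
        (trans (colSum-+ (λ r s → b r s + unitAt p₁ r s) (unitAt p₂) k) (cong (_+ colSum (unitAt p₂) k) (colSum-+ b (unitAt p₁) k))))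

  cancel-≤ : ∀ a b c d → a + c ≡ (b + d) + c → b ≤ a
  cancel-≤ a b c d e = NP.≤-trans (NP.m≤m+n b d) (NP.≤-reflexive (NP.+-cancelʳ-≡ c (b + d) a (sym e)))

  cover⇒colSum≤ : ∀ {A B} → Covers A B → ∀ k → colSum (entry B) k ≤ colSum (entry A) k
  cover⇒colSum≤ {A} {B} (inj₁ (i , j , l , i<j , j<l , conds)) k =
    cancel-≤ _ _ _ (colSum (unitAt (i , j)) k) (trans (cong (λ c → colSum (entry A) k + c) sameColumn) (colSum-move eq k))
    where
    eq : MoveEquation (entry A) (entry B) (i , j) (j , l) (i , l)
    eq = conditions⇒equation A B (i , j) (j , l) (i , l) (triangle-distinct i<j j<l) conds
    sameColumn : colSum (unitAt (j , l)) k ≡ colSum (unitAt (i , l)) k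
    sameColumn = trans (colSum-unit (toℕ j) (toℕ l) j<l (FP.toℕ<n l) k)
                       (sym (colSum-unit (toℕ i) (toℕ l) (NP.<-trans i<j j<l) (FP.toℕ<n l) k))
  cover⇒colSum≤ {A} {B} (inj₂ (i , j , i<j , conds)) k =
    cancel-≤ _ _ _ (colSum (unitAt (i , j)) k)
      (trans (cong (λ c → colSum (entry A) k + c) (trans (colSum-unitDiag (toℕ j) k) (sym (colSum-unitDiag (toℕ i) k))))
             (colSum-move eq k))
    where
    eq : MoveEquation (entry A) (entry B) (i , j) (j , j) (i , i)
    eq = conditions⇒equation A B (i , j) (j , j) (i , i) (diagonal-distinct i<j) conds

  ≤P⇒colSum≤ : ∀ {A B} → B ≤P A → ∀ k → colSum (entry B) k ≤ colSum (entry A) k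
  ≤P⇒colSum≤ ε k = NP.≤-refl
  ≤P⇒colSum≤ {A} {B} (_◅_ {j = C} c cs) k = NP.≤-trans (cover⇒colSum≤ {C} {B} c k) (≤P⇒colSum≤ {A} {C} cs k)

  pos : ∀ {u v} → u < n → v < n → Position
  pos p q = idx p , idx q

  unitAt-pos : ∀ {u v} (p : u < n) (q : v < n) r s → unitAt (pos p q) r s ≡ unit u v (toℕ r) (toℕ s)
  unitAt-pos p q r s = cong₂ (λ a b → unit a b (toℕ r) (toℕ s)) (toℕ-idx p) (toℕ-idx q)

  fromFun-move : ∀ GA GB {u₁ v₁ u₂ v₂ u₃ v₃}
                 (p₁ : u₁ < n) (q₁ : v₁ < n) (p₂ : u₂ < n) (q₂ : v₂ < n) (p₃ : u₃ < n) (q₃ : v₃ < n) →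
                 (∀ r s → GA r s + unit u₃ v₃ r s ≡ (GB r s + unit u₁ v₁ r s) + unit u₂ v₂ r s) →
                 MoveEquation (entry (fromFun GA)) (entry (fromFun GB)) (pos p₁ q₁) (pos p₂ q₂) (pos p₃ q₃)
  fromFun-move GA GB p₁ q₁ p₂ q₂ p₃ q₃ h r s
    rewrite entry-fromFun GA r s | entry-fromFun GB r s
          | unitAt-pos p₁ q₁ r s | unitAt-pos p₂ q₂ r s | unitAt-pos p₃ q₃ r s = h (toℕ r) (toℕ s)

  idx< : ∀ {u v} (p : u < n) (q : v < n) → u < v → idx p F.< idx q
  idx< p q u<v = subst₂ _<_ (sym (toℕ-idx p)) (sym (toℕ-idx q)) u<v

  cover-triangle : ∀ {u v w} GA GB → u < v → v < w → w < n →
                   (∀ r s → GA r s + unit u w r s ≡ (GB r s + unit u v r s) + unit v w r s) → Covers (fromFun GA) (fromFun GB)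
  cover-triangle {u} {v} {w} GA GB u<v v<w w<n h = inj₁ (idx u<n , idx v<n , idx w<n , i<j , j<k , conds)
    where
    v<n : v < n
    v<n = NP.<-trans v<w w<n
    u<n : u < n
    u<n = NP.<-trans u<v v<n
    i<j : idx u<n F.< idx v<n
    i<j = idx< u<n v<n u<v
    j<k : idx v<n F.< idx w<n
    j<k = idx< v<n w<n v<w
    conds : MoveConditions (fromFun GA) (fromFun GB) (pos u<n v<n) (pos v<n w<n) (pos u<n w<n)
    conds = equation⇒conditions (fromFun GA) (fromFun GB) (pos u<n v<n) (pos v<n w<n) (pos u<n w<n)
              (triangle-distinct i<j j<k) (fromFun-move GA GB u<n v<n v<n w<n u<n w<n h)

  cover-diagonal : ∀ {u v} GA GB → u < v → v < n →
                   (∀ r s → GA r s + unit u u r s ≡ (GB r s + unit u v r s) + unit v v r s) → Covers (fromFun GA) (fromFun GB)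
  cover-diagonal {u} {v} GA GB u<v v<n h = inj₂ (idx u<n , idx v<n , i<j , conds)
    where
    u<n : u < n
    u<n = NP.<-trans u<v v<n
    i<j : idx u<n F.< idx v<n
    i<j = idx< u<n v<n u<v
    conds : MoveConditions (fromFun GA) (fromFun GB) (pos u<n v<n) (pos v<n v<n) (pos u<n u<n)
    conds = equation⇒conditions (fromFun GA) (fromFun GB) (pos u<n v<n) (pos v<n v<n) (pos u<n u<n)
              (diagonal-distinct i<j) (fromFun-move GA GB u<n v<n v<n v<n u<n u<n h)

  shift : (ℕ → ℕ → ℕ) → Matrix n → Matrix n
  shift H X = V.tabulate (λ i → V.tabulate (λ j → entry X i j + H (toℕ i) (toℕ j)))

  entry-shift : ∀ H X i j → entry (shift H X) i j ≡ entry X i j + H (toℕ i) (toℕ j)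
  entry-shift H X i j =
    trans (cong (λ r → V.lookup r j) (VP.lookup∘tabulate (λ i → V.tabulate (λ j → entry X i j + H (toℕ i) (toℕ j))) i))
          (VP.lookup∘tabulate (λ j → entry X i j + H (toℕ i) (toℕ j)) j)

  shift-fromFun : ∀ H G → shift H (fromFun G) ≡ fromFun (λ i j → G i j + H i j)
  shift-fromFun H G = matrix-ext (shift H (fromFun G)) (λ i j → G i j + H i j)
    (λ i j → trans (entry-shift H (fromFun G) i j) (cong (_+ H (toℕ i) (toℕ j)) (entry-fromFun G i j)))

  add-both : ∀ a b e₁ e₂ e₃ h → a + e₃ ≡ (b + e₁) + e₂ → (a + h) + e₃ ≡ ((b + h) + e₁) + e₂
  add-both a b e₁ e₂ e₃ h e = trans (swap a h e₃) (trans (cong (_+ h) e) (sym (swap₂ b h e₁ e₂)))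
    where
    swap : ∀ a h e → (a + h) + e ≡ (a + e) + h
    swap = solve-∀
    swap₂ : ∀ b h e₁ e₂ → ((b + h) + e₁) + e₂ ≡ ((b + e₁) + e₂) + h
    swap₂ = solve-∀

  shift-equation : ∀ H A B {p₁ p₂ p₃} → MoveEquation (entry A) (entry B) p₁ p₂ p₃ →
                   MoveEquation (entry (shift H A)) (entry (shift H B)) p₁ p₂ p₃
  shift-equation H A B {p₁} {p₂} {p₃} eq r s rewrite entry-shift H A r s | entry-shift H B r s =
    add-both (entry A r s) (entry B r s) (unitAt p₁ r s) (unitAt p₂ r s) (unitAt p₃ r s) (H (toℕ r) (toℕ s)) (eq r s)

  covers-shift : ∀ H {X Y} → Covers X Y → Covers (shift H X) (shift H Y)
  covers-shift H {X} {Y} (inj₁ (i , j , k , i<j , j<k , conds)) = inj₁ (i , j , k , i<j , j<k ,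
    equation⇒conditions (shift H X) (shift H Y) (i , j) (j , k) (i , k) distinct
      (shift-equation H X Y (conditions⇒equation X Y (i , j) (j , k) (i , k) distinct conds)))
    where
    distinct : Distinct₃ (i , j) (j , k) (i , k)
    distinct = triangle-distinct i<j j<k
  covers-shift H {X} {Y} (inj₂ (i , j , i<j , conds)) = inj₂ (i , j , i<j ,
    equation⇒conditions (shift H X) (shift H Y) (i , j) (j , j) (i , i) distinct
      (shift-equation H X Y (conditions⇒equation X Y (i , j) (j , j) (i , i) distinct conds)))
    where
    distinct : Distinct₃ (i , j) (j , j) (i , i)
    distinct = diagonal-distinct i<j

  dropFirst : ∀ {u v vs} → Chain n u (v L.∷ vs) → fromFun (teslerFun u vs) ≤P fromFun (teslerFun u (v L.∷ vs))
  dropFirst {u} {v} {L.[]} (step u<v (end v<n)) =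
    cover-diagonal (teslerFun u (v L.∷ L.[])) (teslerFun u L.[]) u<v v<n
      (λ r s → rearrange (unit u v r s) (unit v v r s) (unit m m r s) (unit u u r s)) ◅ ε
    where
    rearrange : ∀ a b c d → ((a + b) + c) + d ≡ ((d + c) + a) + b
    rearrange = solve-∀
  dropFirst {u} {v} {w L.∷ ws} (step u<v (step v<w c)) =
    cover-triangle (teslerFun u (v L.∷ w L.∷ ws)) (teslerFun u (w L.∷ ws)) u<v v<w (chain-bound c)
      (λ r s → rearrange (unit u v r s) (unit v w r s) (pathFun w ws r s) (unit m m r s) (unit u w r s)) ◅ ε
    where
    rearrange : ∀ a b p c d → ((a + (b + p)) + c) + d ≡ (((d + p) + c) + a) + b
    rearrange = solve-∀

  teslerFun-mono : ∀ {u ws vs} → Chain n u vs → ws Sublist.⊆ vs → fromFun (teslerFun u ws) ≤P fromFun (teslerFun u vs)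
  teslerFun-mono c Sublist.[] = ε
  teslerFun-mono (step u<v c) (v Sublist.∷ʳ ws⊆vs) = teslerFun-mono (chain-weaken u<v c) ws⊆vs ◅◅ dropFirst (step u<v c)
  teslerFun-mono {u} {v L.∷ ws} {v L.∷ vs} (step u<v c) (refl Sublist.∷ ws⊆vs) =
    subst₂ _≤P_ (addEdge ws) (addEdge vs)
      (gmap (shift (unit u v)) (λ {X} {Y} cover → covers-shift (unit u v) {Y} {X} cover) (teslerFun-mono c ws⊆vs))
    where
    rearrange : ∀ a p l → (p + l) + a ≡ (a + p) + l
    rearrange = solve-∀
    addEdge : ∀ xs → shift (unit u v) (fromFun (teslerFun v xs)) ≡ fromFun (teslerFun u (v L.∷ xs))
    addEdge xs = trans (shift-fromFun (unit u v) (teslerFun v xs))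
                       (fromFun-cong (λ i j → rearrange (unit u v i j) (pathFun v xs i j) (unit m m i j)))

  elements-⊆ : ∀ {k} {T S : Subset k} o → T ⊆ S → elements T o Sublist.⊆ elements S o
  elements-⊆ {T = V.[]} {V.[]} o T⊆S = Sublist.[]
  elements-⊆ {T = inside V.∷ T} {inside V.∷ S} o T⊆S = refl Sublist.∷ elements-⊆ (suc o) (drop-∷-⊆ T⊆S)
  elements-⊆ {T = outside V.∷ T} {inside V.∷ S} o T⊆S = o Sublist.∷ʳ elements-⊆ (suc o) (drop-∷-⊆ T⊆S)
  elements-⊆ {T = outside V.∷ T} {outside V.∷ S} o T⊆S = elements-⊆ (suc o) (drop-∷-⊆ T⊆S)
  elements-⊆ {T = inside V.∷ T} {outside V.∷ S} o T⊆S with T⊆S V.here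
  ... | ()

  subsetMatrix-mono : ∀ {T S} → T ⊆ S → subsetMatrix T ≤P subsetMatrix S
  subsetMatrix-mono {T} {S} T⊆S = teslerFun-mono (subsetChain S) (elements-⊆ 1 T⊆S)

  subsetMatrix-reflects : ∀ {T S} → subsetMatrix T ≤P subsetMatrix S → T ⊆ S
  subsetMatrix-reflects {T} {S} T≤S {x} x∈T = VP.lookup⇒[]= x S (bitSet (subst₂ _≤_
    (trans (colSum-subsetMatrix T x) (cong (λ b → if b then 1 else 0) (VP.[]=⇒lookup x∈T)))
    (colSum-subsetMatrix S x)
    (≤P⇒colSum≤ T≤S (F.suc x))))
    where
    bitSet : ∀ {b} → 1 ≤ (if b then 1 else 0) → b ≡ true
    bitSet {true} _ = refl

  module TeslerPoset (1≤m : 1 ≤ m) where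

    zeroHat≡ : diagM (aVec n) ≡ subsetMatrix Sub.⊥
    zeroHat≡ = trans (matrix-ext (diagM (aVec n)) (teslerFun 0 L.[]) diagonal)
                     (cong (λ vs → fromFun (teslerFun 0 vs)) (sym (elements-empty m 1)))
      where
      diagEntry : ∀ i j → entry (diagM (aVec n)) i j ≡ (if does (i F.≟ j) then V.lookup (aVec n) i else 0)
      diagEntry i j =
        trans (cong (λ r → V.lookup r j) (VP.lookup∘tabulate (λ i → V.tabulate (λ j → if does (i F.≟ j) then V.lookup (aVec n) i else 0)) i))
              (VP.lookup∘tabulate (λ j → if does (i F.≟ j) then V.lookup (aVec n) i else 0) j)
      diagonal : ∀ i j → entry (diagM (aVec n)) i j ≡ teslerFun 0 L.[] (toℕ i) (toℕ j)
      diagonal i j with i F.≟ j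
      ... | yes refl = trans (diagEntry i i) (trans (if-yes (i F.≟ i) refl)
                         (trans (aVec≡δ 1≤m i) (sym (cong₂ _+_ (unit-diag 0 (toℕ i)) (unit-diag m (toℕ i))))))
      ... | no i≢j = trans (diagEntry i j) (trans (if-no (i F.≟ j) i≢j)
                       (sym (cong₂ _+_ (unit-offDiag 0 toℕ≢) (unit-offDiag m toℕ≢))))
        where
        toℕ≢ : toℕ i ≢ toℕ j
        toℕ≢ e = i≢j (FP.toℕ-injective e)

    module Presented (L : List (Matrix n)) (unique : Unique L) (members : ∀ (A : Matrix n) → (A ∈ L) ⇔ Tesler (aVec n) A)
                  (dec : ∀ (A B : Matrix n) → Dec (A ≤P B)) where

      open Poset (aVec n) L dec

      subsetMatrix∈L : ∀ S → subsetMatrix S ∈ L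
      subsetMatrix∈L S = Equivalence.from (members (subsetMatrix S)) (tesler-path 1≤m (subsetChain S))

      ∈L⇒subsetMatrix : ∀ A → A ∈ L → A ≡ subsetMatrix (subsetOf A)
      ∈L⇒subsetMatrix A A∈L = tesler⇒subsetMatrix 1≤m A (Equivalence.to (members A) A∈L)

      L↭subsetMatrices : L ↭ L.map subsetMatrix (allSubsets m)
      L↭subsetMatrices = ∼bag⇒↭ (unique∧set⇒bag unique
        (UP.map⁺ subsetMatrix-injective (allSubsets-unique m)) (λ {A} → mk⇔ (to A) (from A)))
        where
        to : ∀ A → A ∈ L → A ∈ L.map subsetMatrix (allSubsets m)
        to A A∈L = subst (_∈ L.map subsetMatrix (allSubsets m)) (sym (∈L⇒subsetMatrix A A∈L))
                         (MP.∈-map⁺ subsetMatrix (allSubsets-complete (subsetOf A)))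
        from : ∀ A → A ∈ L.map subsetMatrix (allSubsets m) → A ∈ L
        from A p with MP.∈-map⁻ subsetMatrix p
        ... | S , _ , refl = subsetMatrix∈L S

      sumOverL : ∀ (g : Matrix n → ℤ) → sumℤ (L.map g L) ≡ sumSubsets m (λ S → g (subsetMatrix S))
      sumOverL g = trans (sumℤ-↭ g L↭subsetMatrices) (sumℤ-map-∘ g subsetMatrix (allSubsets m))

      rankP≡m : rankP ≡ m
      rankP≡m = NP.≤-antisym (foldr-⊔-lub (L.map rank L) m bounded) (subst (_≤ rankP) rankFull
        (foldr-⊔-ub (L.map rank L) _ (MP.∈-map⁺ rank (subsetMatrix∈L Sub.⊤))))
        where
        bounded : ∀ r → r ∈ L.map rank L → r ≤ m
        bounded r p with MP.∈-map⁻ rank p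
        ... | A , A∈L , refl rewrite ∈L⇒subsetMatrix A A∈L | rank-subsetMatrix (subsetOf A) = ∣p∣≤n (subsetOf A)
        rankFull : rank (subsetMatrix Sub.⊤) ≡ m
        rankFull = trans (rank-subsetMatrix Sub.⊤) (∣⊤∣≡n m)

      Below? : ∀ A B → Dec (zeroHat ≤P B × B ≤P A × ¬ (B ≡ A))
      Below? A B = dec zeroHat B ×-dec dec B A ×-dec ¬? (B ≟M A)

      muFuel-zeroHat : ∀ f A → A ≡ zeroHat → muFuel (suc f) A ≡ + 1
      muFuel-zeroHat f A A≡0̂ with A ≟M zeroHat
      ... | yes _ = refl
      ... | no A≢0̂ = ⊥-elim (A≢0̂ A≡0̂)

      muFuel-above : ∀ f A → A ≢ zeroHat → muFuel (suc f) A ≡ Z.- sumℤ (L.map (muFuel f) (L.filter (Below? A) L))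
      muFuel-above f A A≢0̂ with A ≟M zeroHat
      ... | yes A≡0̂ = ⊥-elim (A≢0̂ A≡0̂)
      ... | no _ = refl

      below⇔⊂ : ∀ T S → (zeroHat ≤P subsetMatrix T × subsetMatrix T ≤P subsetMatrix S × ¬ (subsetMatrix T ≡ subsetMatrix S)) ⇔ T ⊂ S
      below⇔⊂ T S = mk⇔
        (λ (_ , T≤S , T≢S) → ⊆∧≢⇒⊂ (subsetMatrix-reflects T≤S) (λ e → T≢S (cong subsetMatrix e)))
        (λ T⊂S → subst (_≤P subsetMatrix T) (sym zeroHat≡) (subsetMatrix-mono {Sub.⊥} {T} ⊥⊆)
               , subsetMatrix-mono (λ x∈T → proj₁ T⊂S x∈T)
               , λ e → ⊂-irref (subsetMatrix-injective e) T⊂S)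

      muFuel-subsetMatrix : ∀ f S → ∣ S ∣ < f → muFuel f (subsetMatrix S) ≡ sign ∣ S ∣
      muFuel-subsetMatrix (suc f) S ∣S∣<f with VP.≡-dec BoolP._≟_ S Sub.⊥
      ... | yes refl = trans (muFuel-zeroHat f (subsetMatrix Sub.⊥) (sym zeroHat≡)) (cong sign (sym (∣⊥∣≡0 m)))
      ... | no S≢⊥ = begin
        muFuel (suc f) (subsetMatrix S)
          ≡⟨ muFuel-above f (subsetMatrix S) (λ e → S≢⊥ (subsetMatrix-injective (trans e zeroHat≡))) ⟩
        Z.- sumℤ (L.map (muFuel f) (L.filter (Below? (subsetMatrix S)) L))
          ≡⟨ cong Z.-_ (sumℤ-filter (Below? (subsetMatrix S)) (muFuel f) L) ⟩
        Z.- sumℤ (L.map (λ B → if does (Below? (subsetMatrix S) B) then muFuel f B else + 0) L)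
          ≡⟨ cong Z.-_ (sumOverL _) ⟩
        Z.- sumSubsets m (λ T → if does (Below? (subsetMatrix S) (subsetMatrix T)) then muFuel f (subsetMatrix T) else + 0)
          ≡⟨ cong Z.-_ (sumSubsets-cong m termwise) ⟩
        Z.- strictDownSum S
          ≡⟨ cong Z.-_ (strictDownSum-nonempty S (≢⊥⇒nonempty S S≢⊥)) ⟩
        Z.- (Z.- sign ∣ S ∣)
          ≡⟨ ZP.neg-involutive (sign ∣ S ∣) ⟩
        sign ∣ S ∣ ∎
        where
        open ≡-Reasoning
        termwise : ∀ T → (if does (Below? (subsetMatrix S) (subsetMatrix T)) then muFuel f (subsetMatrix T) else + 0)
                         ≡ (if does (T ⊂? S) then sign ∣ T ∣ else + 0)
        termwise T = trans (cong (λ b → if b then muFuel f (subsetMatrix T) else + 0)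
                                 (does-⇔ (below⇔⊂ T S) (Below? (subsetMatrix S) (subsetMatrix T)) (T ⊂? S)))
                           (if-cong (T ⊂? S) (λ T⊂S → muFuel-subsetMatrix f T (NP.<-≤-trans (p⊂q⇒∣p∣<∣q∣ T⊂S) (NP.≤-pred ∣S∣<f))))

      mobius-subsetMatrix : ∀ S → mobius (subsetMatrix S) ≡ sign ∣ S ∣
      mobius-subsetMatrix S = muFuel-subsetMatrix (suc (rank (subsetMatrix S))) S (s≤s (NP.≤-reflexive (sym (rank-subsetMatrix S))))

      charPoly≡ : ∀ q → charPoly q ≡ (q - + 1) ^ m
      charPoly≡ q = begin
        charPoly q
          ≡⟨ sumOverL (λ A → mobius A Z.* q ^ (rankP ∸ rank A)) ⟩
        sumSubsets m (λ S → mobius (subsetMatrix S) Z.* q ^ (rankP ∸ rank (subsetMatrix S)))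
          ≡⟨ sumSubsets-cong m (λ S → cong₂ (λ μ e → μ Z.* q ^ e) (mobius-subsetMatrix S) (cong₂ _∸_ rankP≡m (rank-subsetMatrix S))) ⟩
        sumSubsets m (λ S → sign ∣ S ∣ Z.* q ^ (m ∸ ∣ S ∣))
          ≡⟨ alternatingRankSum m q ⟩
        (q - + 1) ^ m ∎
        where open ≡-Reasoning

mainTheorem6 : ∀ (n : ℕ) → 2 ≤ n →
    (L : List (Matrix n)) → Unique L → (∀ (A : Matrix n) → (A ∈ L) ⇔ Tesler (aVec n) A) →
    (dec : ∀ (A B : Matrix n) → Dec (A ≤P B)) →
    ∀ (q : ℤ) → Poset.charPoly (aVec n) L dec q ≡ (q - + 1) ^ (n ∸ 1)
mainTheorem6 (suc (suc k)) _ L unique members dec q =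
  Matrices.TeslerPoset.Presented.charPoly≡ (suc k) (s≤s z≤n) L unique members dec q
mainTheorem6 (suc zero) (s≤s ())
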